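{- Let $G=\mathrm{PSL}(2,13)$ act by right multiplication on the set of right cosets of a subgroup $H\cong A_4$ (degree $91=7\cdot13$). Then every generalized orbital graph of this action contains a Hamilton cycle.
   Context: For a group $G$ acting transitively on a set $\Omega$, the orbitals are the orbits of $G$ on $\Omega\times\Omega$. A generalized orbital graph is a graph with vertex set $\Omega$ and edge set $\mathcal{O}$, where $\mathcal{O}$ is a nonempty union of orbitals not containing the diagonal and closed under $(x,y)\mapsto(y,x)$. -}

module Defs where

open import Data.Nat using (ℕ; zero; suc; _+_; _*_; _∸_; _<ᵇ_)
open import Data.Nat.DivMod using (_mod_; _%_)
open import Data.Fin using (Fin; toℕ)
open import Data.Vec using (Vec; lookup; tabulate)
open import Data.List using (List; map; concatMap; allFin)
open import Data.Nat.ListAction using (sum)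
open import Data.Bool using (Bool; true; false; if_then_else_; _∧_)
open import Data.Product using (Σ; ∃; _×_; _,_)
open import Data.Sum using (_⊎_)
open import Relation.Binary.PropositionalEquality using (_≡_)

F : Set
F = Fin 13

_+F_ : F → F → F
a +F b = (toℕ a + toℕ b) mod 13

_*F_ : F → F → F
a *F b = (toℕ a * toℕ b) mod 13

-F_ : F → F
-F a = (13 ∸ toℕ a) mod 13

0F 1F : F
0F = 0 mod 13
1F = 1 mod 13

record Mat : Set where
  constructor mat
  field
    a b c d : F

open Mat public

det : Mat → F
det m = (a m *F d m) +F (-F (b m *F c m))

SL : Mat → Set
SL m = det m ≡ 1F

_*M_ : Mat → Mat → Mat
x *M y = mat ((a x *F a y) +F (b x *F c y)) ((a x *F b y) +F (b x *F d y))
             ((c x *F a y) +F (d x *F c y)) ((c x *F b y) +F (d x *F d y))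

IM : Mat
IM = mat 1F 0F 0F 1F

negM : Mat → Mat
negM x = mat (-F a x) (-F b x) (-F c x) (-F d x)

-- inverse of a determinant-1 matrix
invM : Mat → Mat
invM x = mat (d x) (-F b x) (-F c x) (a x)

-- PSL(2,13) = SL(2,13)/{±I}: elements are SL matrices, equal up to sign
_≈P_ : Mat → Mat → Set
x ≈P y = x ≡ y ⊎ x ≡ negM y

-- Subgroups of PSL(2,13), given by their (sign-closed) preimage in SL(2,13)

record IsPSLSubgroup (H : Mat → Set) : Set where
  field
    ⊆SL    : ∀ x → H x → SL x
    resp   : ∀ x y → x ≈P y → H x → H y
    hasId  : H IM
    mulClosed : ∀ x y → H x → H y → H (x *M y)
    invClosed : ∀ x → H x → H (invM x)

Perm4 : Set
Perm4 = Vec (Fin 4) 4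

inversions : Perm4 → ℕ
inversions σ = sum (concatMap (λ i → map (λ j →
  if (toℕ i <ᵇ toℕ j) ∧ (toℕ (lookup σ j) <ᵇ toℕ (lookup σ i)) then 1 else 0)
  (allFin 4)) (allFin 4))

IsA4 : Perm4 → Set
IsA4 σ = (∀ i j → lookup σ i ≡ lookup σ j → i ≡ j) × (inversions σ % 2 ≡ 0)

_∘P_ : Perm4 → Perm4 → Perm4
σ ∘P τ = tabulate (λ i → lookup σ (lookup τ i))

record IsoToA4 (H : Mat → Set) : Set where
  field
    φ     : Perm4 → Mat
    into  : ∀ σ → IsA4 σ → H (φ σ)
    hom   : ∀ σ τ → IsA4 σ → IsA4 τ → φ (σ ∘P τ) ≈P (φ σ *M φ τ)
    inj   : ∀ σ τ → IsA4 σ → IsA4 τ → φ σ ≈P φ τ → σ ≡ τ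
    onto  : ∀ g → H g → Σ Perm4 (λ σ → IsA4 σ × φ σ ≈P g)

-- Right cosets Hx (x ∈ SL); Hx = Hy iff y x⁻¹ ∈ H.  G acts by Hx·g = H(xg).

SameCoset : (Mat → Set) → Mat → Mat → Set
SameCoset H x y = H (y *M invM x)

-- O : characteristic function of a set of pairs of cosets (given on
-- representatives).  Generalized orbital graph conditions:
record IsGenOrbitalGraph (H : Mat → Set) (O : Mat → Mat → Bool) : Set where
  field
    wellDef  : ∀ x x' y y' → SL x → SL x' → SL y → SL y' →
               SameCoset H x x' → SameCoset H y y' → O x y ≡ O x' y'
    unionOrb : ∀ x y g → SL x → SL y → SL g →
               O x y ≡ true → O (x *M g) (y *M g) ≡ true
    noDiag   : ∀ x → SL x → O x x ≡ false
    symm     : ∀ x y → SL x → SL y → O x y ≡ O y x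
    nonempty : Σ Mat (λ x → Σ Mat (λ y → SL x × SL y × O x y ≡ true))

nextF : ∀ {n} → Fin (suc n) → Fin (suc n)
nextF {n} i = suc (toℕ i) mod (suc n)

-- Hamilton cycle: a cyclic enumeration v 0, …, v (m-1) (m ≥ 3) of all
-- cosets, each exactly once, consecutive ones (cyclically) adjacent.
HasHamiltonCycle : (Mat → Set) → (Mat → Mat → Bool) → Set
HasHamiltonCycle H O =
  Σ ℕ λ n → Σ (Fin (suc (suc (suc n))) → Mat) λ v →
    (∀ i → SL (v i)) ×
    (∀ i j → SameCoset H (v i) (v j) → i ≡ j) ×
    (∀ x → SL x → Σ (Fin (suc (suc (suc n)))) (λ i → SameCoset H x (v i))) ×
    (∀ i → O (v i) (v (nextF i)) ≡ true)

-- All subgroups of PSL(2,13) isomorphic to A₄ are conjugate.  Writing A₄ = ⟨α, β | α², β³, (αβ)³⟩,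
-- the image A of α is an involution and can be conjugated to the fixed involution A₀; then one of
-- three further conjugations moves the image of β so that the pair generates the fixed copy H₀.
-- Both steps are checked exhaustively over all 13⁴ matrices, computing in a model over ℕ.
-- Conjugation by c is an isomorphism of coset actions (Hx ↦ H'cx), so it suffices to treat H₀.
-- For H₀ there are 91 cosets, and the 90 nontrivial ones fall into 10 orbits under H₀.  A generalized
-- orbital graph contains, along with any edge, a whole orbital, hence an edge (H₀, H₀sⱼ) to one of
-- the 10 orbit representatives sⱼ; for each j an explicit Hamilton cycle is given all of whose edges
-- are images of (H₀, H₀sⱼ) or of its reverse.

module Submission where

open import Defs
open import Level using (0ℓ)
open import Function using (_∘_; _$_; _⇔_; mk⇔; Equivalence)
open import Data.Bool using (Bool; true; false; _∧_; _∨_; not)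
open import Data.Nat using (ℕ; zero; suc; _+_; _*_; _∸_; _%_; _≡ᵇ_; _<ᵇ_)
open import Data.Nat.Properties using (≡ᵇ⇒≡; ≡⇒≡ᵇ; <ᵇ⇒<)
open import Data.Bool.Properties using (T-≡)
open import Data.Nat.DivMod using (_mod_; m<n⇒m%n≡m)
open import Data.Fin using (Fin; zero; suc; toℕ; #_)
open import Data.Fin.Properties using (toℕ-injective; toℕ-fromℕ<)
open import Data.Vec using (Vec; []; _∷_; lookup; tabulate)
open import Data.Vec.Properties using (tabulate∘lookup; tabulate-cong)
open import Data.Vec.Relation.Unary.All.Properties using (lookup⁻)
open import Data.Vec.Relation.Unary.Unique.Propositional using (Unique; []; _∷_)
open import Data.Vec.Relation.Unary.Unique.Propositional.Properties using (lookup-injective)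
open import Data.Product using (∃-syntax; _×_; _,_; proj₁; proj₂)
open import Data.Sum using (_⊎_; inj₁; inj₂)
open import Data.Maybe using (just; nothing)
open import Data.Empty using (⊥-elim)
open import Relation.Nullary using (¬_)
open import Relation.Binary.Bundles using (Setoid)
open import Relation.Binary.PropositionalEquality hiding (resp)
import Relation.Binary.Reasoning.Setoid as SetoidReasoning
open import Algebra.Bundles using (CommutativeRing)
open import Tactic.RingSolver using (solve-∀)
open import Tactic.RingSolver.Core.AlmostCommutativeRing using (AlmostCommutativeRing; fromCommutativeRing)
open Equivalence using (to; from)

-- Checks are stated as b ≡ true rather than T b: the conversion checker then compares two
-- checks through the data type _≡_, instead of re-evaluating b to decide whether T b is ⊤.

∧-split : ∀ {x y} → x ∧ y ≡ true → x ≡ true × y ≡ true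
∧-split {true} p = refl , p

∧-intro : ∀ {x y} → x ≡ true → y ≡ true → x ∧ y ≡ true
∧-intro refl q = q

∨-split : ∀ {x y} → x ∨ y ≡ true → x ≡ true ⊎ y ≡ true
∨-split {true}  _ = inj₁ refl
∨-split {false} q = inj₂ q

∨-introˡ : ∀ {x y} → x ≡ true → x ∨ y ≡ true
∨-introˡ refl = refl

∨-introʳ : ∀ {x y} → y ≡ true → x ∨ y ≡ true
∨-introʳ {true}  _ = refl
∨-introʳ {false} q = q

implies-elim : ∀ {x y} → not x ∨ y ≡ true → x ≡ true → y ≡ true
implies-elim q refl = q

implies-intro : ∀ {x y} → (x ≡ true → y ≡ true) → not x ∨ y ≡ true
implies-intro {true}  f = f refl
implies-intro {false} f = refl

not-intro : ∀ {x} → x ≢ true → not x ≡ true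
not-intro {true}  x≢true = ⊥-elim (x≢true refl)
not-intro {false} _      = refl

not-elim : ∀ {x} → not x ≡ true → x ≢ true
not-elim {false} _ ()

allFinᵇ : ∀ n → (Fin n → Bool) → Bool
allFinᵇ zero    f = true
allFinᵇ (suc n) f = f zero ∧ allFinᵇ n (f ∘ suc)

allFinᵇ-sound : ∀ n (f : Fin n → Bool) → allFinᵇ n f ≡ true → ∀ i → f i ≡ true
allFinᵇ-sound (suc n) f p zero    = proj₁ (∧-split {f zero} p)
allFinᵇ-sound (suc n) f p (suc i) = allFinᵇ-sound n (f ∘ suc) (proj₂ (∧-split {f zero} p)) i

allFinᵇ-complete : ∀ n (f : Fin n → Bool) → (∀ i → f i ≡ true) → allFinᵇ n f ≡ true
allFinᵇ-complete zero    f h = refl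
allFinᵇ-complete (suc n) f h = ∧-intro (h zero) (allFinᵇ-complete n (f ∘ suc) (h ∘ suc))

allᵇ : ∀ {A : Set} {n} → (A → Bool) → Vec A n → Bool
allᵇ p []       = true
allᵇ p (x ∷ xs) = p x ∧ allᵇ p xs

anyᵇ : ∀ {A : Set} {n} → (A → Bool) → Vec A n → Bool
anyᵇ p []       = false
anyᵇ p (x ∷ xs) = p x ∨ anyᵇ p xs

allᵇ-sound : ∀ {A : Set} {n} (p : A → Bool) (xs : Vec A n) → allᵇ p xs ≡ true → ∀ i → p (lookup xs i) ≡ true
allᵇ-sound p (x ∷ xs) q zero    = proj₁ (∧-split {p x} q)
allᵇ-sound p (x ∷ xs) q (suc i) = allᵇ-sound p xs (proj₂ (∧-split {p x} q)) i

anyᵇ-sound : ∀ {A : Set} {n} (p : A → Bool) (xs : Vec A n) → anyᵇ p xs ≡ true → ∃[ i ] p (lookup xs i) ≡ true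
anyᵇ-sound p (x ∷ xs) q with ∨-split {p x} q
... | inj₁ r = zero , r
... | inj₂ r = let i , r' = anyᵇ-sound p xs r in suc i , r'

anyᵇ-complete : ∀ {A : Set} {n} (p : A → Bool) (xs : Vec A n) i → p (lookup xs i) ≡ true → anyᵇ p xs ≡ true
anyᵇ-complete p (x ∷ xs) zero    r = ∨-introˡ r
anyᵇ-complete p (x ∷ xs) (suc i) r = ∨-introʳ {p x} (anyᵇ-complete p xs i r)

allVecᵇ : ∀ {k} n → (Vec (Fin k) n → Bool) → Bool
allVecᵇ zero        p = p []
allVecᵇ {k} (suc n) p = allFinᵇ k λ x → allVecᵇ n (p ∘ (x ∷_))

allVecᵇ-sound : ∀ {k} n (p : Vec (Fin k) n → Bool) → allVecᵇ n p ≡ true → ∀ v → p v ≡ true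
allVecᵇ-sound zero        p q []       = q
allVecᵇ-sound {k} (suc n) p q (x ∷ v) =
  allVecᵇ-sound n (p ∘ (x ∷_)) (allFinᵇ-sound k (λ x → allVecᵇ n (p ∘ (x ∷_))) q x) v

≡ᵇ-sound : ∀ m n → (m ≡ᵇ n) ≡ true → m ≡ n
≡ᵇ-sound m n p = ≡ᵇ⇒≡ m n (from T-≡ p)

≡ᵇ-complete : ∀ m n → m ≡ n → (m ≡ᵇ n) ≡ true
≡ᵇ-complete m n p = to T-≡ (≡⇒≡ᵇ m n p)

_≡ᶠᵇ_ : ∀ {n} → Fin n → Fin n → Bool
i ≡ᶠᵇ j = toℕ i ≡ᵇ toℕ j

≡ᶠᵇ-sound : ∀ {n} (i j : Fin n) → i ≡ᶠᵇ j ≡ true → i ≡ j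
≡ᶠᵇ-sound i j p = toℕ-injective (≡ᵇ-sound (toℕ i) (toℕ j) p)

≡ᶠᵇ-refl : ∀ {n} (i : Fin n) → i ≡ᶠᵇ i ≡ true
≡ᶠᵇ-refl i = ≡ᵇ-complete (toℕ i) (toℕ i) refl

injectiveᵇ : ∀ {m n} → (Fin m → Fin n) → Bool
injectiveᵇ {m} f = allFinᵇ m λ i → allFinᵇ m λ i' → not (f i ≡ᶠᵇ f i') ∨ (i ≡ᶠᵇ i')

injectiveᵇ-sound : ∀ {m n} (f : Fin m → Fin n) → injectiveᵇ f ≡ true → ∀ i i' → f i ≡ f i' → i ≡ i'
injectiveᵇ-sound {m} f p i i' eq = ≡ᶠᵇ-sound i i' (implies-elim
  (allFinᵇ-sound m (λ i' → not (f i ≡ᶠᵇ f i') ∨ (i ≡ᶠᵇ i'))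
    (allFinᵇ-sound m (λ i → allFinᵇ m λ i' → not (f i ≡ᶠᵇ f i') ∨ (i ≡ᶠᵇ i')) p i) i')
  (subst (λ k → f i ≡ᶠᵇ k ≡ true) eq (≡ᶠᵇ-refl (f i))))

injectiveᵇ-complete : ∀ {m n} (f : Fin m → Fin n) → (∀ i i' → f i ≡ f i' → i ≡ i') → injectiveᵇ f ≡ true
injectiveᵇ-complete {m} f inj =
  allFinᵇ-complete m _ λ i → allFinᵇ-complete m _ λ i' → implies-intro λ p →
    subst (λ k → i ≡ᶠᵇ k ≡ true) (inj i i' (≡ᶠᵇ-sound (f i) (f i') p)) (≡ᶠᵇ-refl i)

uniqueᵇ : ∀ {k n} → Vec (Fin k) n → Bool
uniqueᵇ []       = true
uniqueᵇ (x ∷ xs) = allᵇ (λ y → not (x ≡ᶠᵇ y)) xs ∧ uniqueᵇ xs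

uniqueᵇ-sound : ∀ {k n} (xs : Vec (Fin k) n) → uniqueᵇ xs ≡ true → Unique xs
uniqueᵇ-sound []       _ = []
uniqueᵇ-sound (x ∷ xs) p =
  let fresh , rest = ∧-split {allᵇ (λ y → not (x ≡ᶠᵇ y)) xs} p
  in lookup⁻ (λ i x≡xᵢ → not-elim (allᵇ-sound (λ y → not (x ≡ᶠᵇ y)) xs fresh i)
                            (subst (λ y → x ≡ᶠᵇ y ≡ true) x≡xᵢ (≡ᶠᵇ-refl x)))
     ∷ uniqueᵇ-sound xs rest

exhaustiveᵇ : ∀ {k n} → Vec (Fin k) n → Bool
exhaustiveᵇ {k} xs = allFinᵇ k λ y → anyᵇ (_≡ᶠᵇ y) xs

exhaustiveᵇ-sound : ∀ {k n} (xs : Vec (Fin k) n) → exhaustiveᵇ xs ≡ true → ∀ y → ∃[ i ] lookup xs i ≡ y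
exhaustiveᵇ-sound {k} xs p y =
  let i , q = anyᵇ-sound (_≡ᶠᵇ y) xs (allFinᵇ-sound k (λ y → anyᵇ (_≡ᶠᵇ y) xs) p y)
  in i , ≡ᶠᵇ-sound (lookup xs i) y q

allF : (F → Bool) → Bool
allF = allFinᵇ 13

≡-by-exhaustion₁ : (f g : F → F) → (allF λ x → f x ≡ᶠᵇ g x) ≡ true → ∀ x → f x ≡ g x
≡-by-exhaustion₁ f g p x = ≡ᶠᵇ-sound _ _ (allFinᵇ-sound 13 (λ x → f x ≡ᶠᵇ g x) p x)

≡-by-exhaustion₂ : (f g : F → F → F) → (allF λ x → allF λ y → f x y ≡ᶠᵇ g x y) ≡ true →
                   ∀ x y → f x y ≡ g x y
≡-by-exhaustion₂ f g p x =
  ≡-by-exhaustion₁ (f x) (g x) (allFinᵇ-sound 13 (λ x → allF λ y → f x y ≡ᶠᵇ g x y) p x)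

≡-by-exhaustion₃ : (f g : F → F → F → F) →
                   (allF λ x → allF λ y → allF λ z → f x y z ≡ᶠᵇ g x y z) ≡ true →
                   ∀ x y z → f x y z ≡ g x y z
≡-by-exhaustion₃ f g p x =
  ≡-by-exhaustion₂ (f x) (g x) (allFinᵇ-sound 13 (λ x → allF λ y → allF λ z → f x y z ≡ᶠᵇ g x y z) p x)

F-commutativeRing : CommutativeRing 0ℓ 0ℓ
F-commutativeRing = record
  { Carrier = F ; _≈_ = _≡_ ; _+_ = _+F_ ; _*_ = _*F_ ; -_ = -F_ ; 0# = 0F ; 1# = 1F
  ; isCommutativeRing = record
    { isRing = record
      { +-isAbelianGroup = record
        { isGroup = record
          { isMonoid = record
            { isSemigroup = record
              { isMagma = record { isEquivalence = isEquivalence ; ∙-cong = cong₂ _+F_ }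
              ; assoc = ≡-by-exhaustion₃ (λ x y z → (x +F y) +F z) (λ x y z → x +F (y +F z)) refl }
            ; identity = ≡-by-exhaustion₁ (0F +F_) (λ x → x) refl
                       , ≡-by-exhaustion₁ (_+F 0F) (λ x → x) refl }
          ; inverse = ≡-by-exhaustion₁ (λ x → (-F x) +F x) (λ _ → 0F) refl
                    , ≡-by-exhaustion₁ (λ x → x +F (-F x)) (λ _ → 0F) refl
          ; ⁻¹-cong = cong -F_ }
        ; comm = ≡-by-exhaustion₂ _+F_ (λ x y → y +F x) refl }
      ; *-cong = cong₂ _*F_
      ; *-assoc = ≡-by-exhaustion₃ (λ x y z → (x *F y) *F z) (λ x y z → x *F (y *F z)) refl
      ; *-identity = ≡-by-exhaustion₁ (1F *F_) (λ x → x) refl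
                   , ≡-by-exhaustion₁ (_*F 1F) (λ x → x) refl
      ; distrib = ≡-by-exhaustion₃ (λ x y z → x *F (y +F z)) (λ x y z → (x *F y) +F (x *F z)) refl
                , ≡-by-exhaustion₃ (λ x y z → (y +F z) *F x) (λ x y z → (y *F x) +F (z *F x)) refl }
    ; *-comm = ≡-by-exhaustion₂ _*F_ (λ x y → y *F x) refl } }

F-ring : AlmostCommutativeRing 0ℓ 0ℓ
F-ring = fromCommutativeRing F-commutativeRing λ { zero → just refl ; _ → nothing }

-- The groups SL(2,13) and PSL(2,13)

mat-cong : ∀ {a b c d a' b' c' d'} → a ≡ a' → b ≡ b' → c ≡ c' → d ≡ d' →
           mat a b c d ≡ mat a' b' c' d'
mat-cong refl refl refl refl = refl

*M-assoc : ∀ x y z → (x *M y) *M z ≡ x *M (y *M z)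
*M-assoc (mat a b c d) (mat a' b' c' d') (mat a'' b'' c'' d'') =
  mat-cong (entry a b a' b' c' d' a'' c'') (entry a b a' b' c' d' b'' d'')
           (entry c d a' b' c' d' a'' c'') (entry c d a' b' c' d' b'' d'')
  where
  entry : ∀ p q r s t u v w →
          (((p *F r) +F (q *F t)) *F v) +F (((p *F s) +F (q *F u)) *F w)
          ≡ (p *F ((r *F v) +F (s *F w))) +F (q *F ((t *F v) +F (u *F w)))
  entry = solve-∀ F-ring

*M-identityˡ : ∀ x → IM *M x ≡ x
*M-identityˡ (mat a b c d) = mat-cong (entry₁ a c) (entry₁ b d) (entry₂ a c) (entry₂ b d)
  where
  entry₁ : ∀ p q → (1F *F p) +F (0F *F q) ≡ p
  entry₁ = solve-∀ F-ring
  entry₂ : ∀ p q → (0F *F p) +F (1F *F q) ≡ q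
  entry₂ = solve-∀ F-ring

*M-identityʳ : ∀ x → x *M IM ≡ x
*M-identityʳ (mat a b c d) = mat-cong (entry₁ a b) (entry₂ a b) (entry₁ c d) (entry₂ c d)
  where
  entry₁ : ∀ p q → (p *F 1F) +F (q *F 0F) ≡ p
  entry₁ = solve-∀ F-ring
  entry₂ : ∀ p q → (p *F 0F) +F (q *F 1F) ≡ q
  entry₂ = solve-∀ F-ring

*M-inverseʳ : ∀ x → SL x → x *M invM x ≡ IM
*M-inverseʳ (mat a b c d) det≡1 =
  mat-cong (trans (diag₁ a b c d) det≡1) (off₁ a b) (off₂ c d) (trans (diag₂ a b c d) det≡1)
  where
  diag₁ : ∀ a b c d → (a *F d) +F (b *F (-F c)) ≡ (a *F d) +F (-F (b *F c))
  diag₁ = solve-∀ F-ring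
  diag₂ : ∀ a b c d → (c *F (-F b)) +F (d *F a) ≡ (a *F d) +F (-F (b *F c))
  diag₂ = solve-∀ F-ring
  off₁ : ∀ a b → (a *F (-F b)) +F (b *F a) ≡ 0F
  off₁ = solve-∀ F-ring
  off₂ : ∀ c d → (c *F d) +F (d *F (-F c)) ≡ 0F
  off₂ = solve-∀ F-ring

*M-inverseˡ : ∀ x → SL x → invM x *M x ≡ IM
*M-inverseˡ (mat a b c d) det≡1 =
  mat-cong (trans (diag₁ a b c d) det≡1) (off₁ b d) (off₂ a c) (trans (diag₂ a b c d) det≡1)
  where
  diag₁ : ∀ a b c d → (d *F a) +F ((-F b) *F c) ≡ (a *F d) +F (-F (b *F c))
  diag₁ = solve-∀ F-ring
  diag₂ : ∀ a b c d → ((-F c) *F b) +F (a *F d) ≡ (a *F d) +F (-F (b *F c))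
  diag₂ = solve-∀ F-ring
  off₁ : ∀ b d → (d *F b) +F ((-F b) *F d) ≡ 0F
  off₁ = solve-∀ F-ring
  off₂ : ∀ a c → ((-F c) *F a) +F (a *F c) ≡ 0F
  off₂ = solve-∀ F-ring

det-*M : ∀ x y → det (x *M y) ≡ det x *F det y
det-*M (mat a b c d) (mat a' b' c' d') = expand a b c d a' b' c' d'
  where
  expand : ∀ a b c d a' b' c' d' →
    (((a *F a') +F (b *F c')) *F ((c *F b') +F (d *F d')))
      +F (-F (((a *F b') +F (b *F d')) *F ((c *F a') +F (d *F c'))))
    ≡ ((a *F d) +F (-F (b *F c))) *F ((a' *F d') +F (-F (b' *F c')))
  expand = solve-∀ F-ring

SL-*M : ∀ x y → SL x → SL y → SL (x *M y)
SL-*M x y sx sy = trans (det-*M x y) (cong₂ _*F_ sx sy)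

SL-invM : ∀ x → SL x → SL (invM x)
SL-invM (mat a b c d) det≡1 = trans (expand a b c d) det≡1
  where
  expand : ∀ a b c d → (d *F a) +F (-F ((-F b) *F (-F c))) ≡ (a *F d) +F (-F (b *F c))
  expand = solve-∀ F-ring

SL-negM : ∀ x → SL x → SL (negM x)
SL-negM (mat a b c d) det≡1 = trans (expand a b c d) det≡1
  where
  expand : ∀ a b c d → ((-F a) *F (-F d)) +F (-F ((-F b) *F (-F c))) ≡ (a *F d) +F (-F (b *F c))
  expand = solve-∀ F-ring

-F-involutive : ∀ a → -F (-F a) ≡ a
-F-involutive = solve-∀ F-ring

negM-distribˡ-*M : ∀ x y → negM x *M y ≡ negM (x *M y)
negM-distribˡ-*M (mat a b c d) (mat a' b' c' d') =
  mat-cong (entry a a' b c') (entry a b' b d') (entry c a' d c') (entry c b' d d')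
  where
  entry : ∀ p q r s → ((-F p) *F q) +F ((-F r) *F s) ≡ -F ((p *F q) +F (r *F s))
  entry = solve-∀ F-ring

negM-distribʳ-*M : ∀ x y → x *M negM y ≡ negM (x *M y)
negM-distribʳ-*M (mat a b c d) (mat a' b' c' d') =
  mat-cong (entry a a' b c') (entry a b' b d') (entry c a' d c') (entry c b' d d')
  where
  entry : ∀ p q r s → (p *F (-F q)) +F (r *F (-F s)) ≡ -F ((p *F q) +F (r *F s))
  entry = solve-∀ F-ring

negM-involutive : ∀ x → negM (negM x) ≡ x
negM-involutive (mat a b c d) =
  mat-cong (-F-involutive a) (-F-involutive b) (-F-involutive c) (-F-involutive d)

invM-anti-homo-*M : ∀ x y → invM (x *M y) ≡ invM y *M invM x
invM-anti-homo-*M (mat a b c d) (mat a' b' c' d') =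
  mat-cong (e₁ a b c d a' b' c' d') (e₂ a b c d a' b' c' d') (e₃ a b c d a' b' c' d') (e₄ a b c d a' b' c' d')
  where
  e₁ : ∀ a b c d a' b' c' d' → (c *F b') +F (d *F d') ≡ (d' *F d) +F ((-F b') *F (-F c))
  e₁ = solve-∀ F-ring
  e₂ : ∀ a b c d a' b' c' d' → -F ((a *F b') +F (b *F d')) ≡ (d' *F (-F b)) +F ((-F b') *F a)
  e₂ = solve-∀ F-ring
  e₃ : ∀ a b c d a' b' c' d' → -F ((c *F a') +F (d *F c')) ≡ ((-F c') *F d) +F (a' *F (-F c))
  e₃ = solve-∀ F-ring
  e₄ : ∀ a b c d a' b' c' d' → (a *F a') +F (b *F c') ≡ ((-F c') *F (-F b)) +F (a' *F a)
  e₄ = solve-∀ F-ring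

≈P-refl : ∀ {x} → x ≈P x
≈P-refl = inj₁ refl

≡⇒≈P : ∀ {x y} → x ≡ y → x ≈P y
≡⇒≈P refl = ≈P-refl

≈P-sym : ∀ {x y} → x ≈P y → y ≈P x
≈P-sym (inj₁ refl) = inj₁ refl
≈P-sym {y = y} (inj₂ refl) = inj₂ (sym (negM-involutive y))

≈P-trans : ∀ {x y z} → x ≈P y → y ≈P z → x ≈P z
≈P-trans (inj₁ refl) q = q
≈P-trans (inj₂ refl) (inj₁ refl) = inj₂ refl
≈P-trans {z = z} (inj₂ refl) (inj₂ refl) = inj₁ (negM-involutive z)

≈P-*M : ∀ {x x' y y'} → x ≈P x' → y ≈P y' → (x *M y) ≈P (x' *M y')
≈P-*M (inj₁ refl) (inj₁ refl) = inj₁ refl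
≈P-*M {x} {y' = y'} (inj₁ refl) (inj₂ refl) = inj₂ (negM-distribʳ-*M x y')
≈P-*M {x' = x'} {y} (inj₂ refl) (inj₁ refl) = inj₂ (negM-distribˡ-*M x' y)
≈P-*M {x' = x'} {y' = y'} (inj₂ refl) (inj₂ refl) = inj₁ (begin
  negM x' *M negM y'     ≡⟨ negM-distribˡ-*M x' (negM y') ⟩
  negM (x' *M negM y')   ≡⟨ cong negM (negM-distribʳ-*M x' y') ⟩
  negM (negM (x' *M y')) ≡⟨ negM-involutive (x' *M y') ⟩
  x' *M y'               ∎)
  where open ≡-Reasoning

≈P-invM : ∀ {x y} → x ≈P y → invM x ≈P invM y
≈P-invM (inj₁ refl) = inj₁ refl
≈P-invM (inj₂ refl) = inj₂ refl

SL-≈P : ∀ {x y} → x ≈P y → SL y → SL x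
SL-≈P (inj₁ refl) sy = sy
SL-≈P {y = y} (inj₂ refl) sy = SL-negM y sy

PSL-setoid : Setoid 0ℓ 0ℓ
PSL-setoid = record
  { Carrier = Mat ; _≈_ = _≈P_
  ; isEquivalence = record { refl = ≈P-refl ; sym = ≈P-sym ; trans = ≈P-trans } }

module ≈P-Reasoning = SetoidReasoning PSL-setoid

*M-cancel-invM-middle : ∀ x y z → SL y → (x *M invM y) *M (y *M z) ≡ x *M z
*M-cancel-invM-middle x y z sy = begin
  (x *M invM y) *M (y *M z) ≡⟨ *M-assoc x (invM y) (y *M z) ⟩
  x *M (invM y *M (y *M z)) ≡⟨ cong (x *M_) (sym (*M-assoc (invM y) y z)) ⟩
  x *M ((invM y *M y) *M z) ≡⟨ cong (λ u → x *M (u *M z)) (*M-inverseˡ y sy) ⟩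
  x *M (IM *M z)            ≡⟨ cong (x *M_) (*M-identityˡ z) ⟩
  x *M z                    ∎
  where open ≡-Reasoning

invM-*M-cancelˡ : ∀ c x → SL c → invM c *M (c *M x) ≡ x
invM-*M-cancelˡ c x sc = begin
  invM c *M (c *M x) ≡⟨ sym (*M-assoc (invM c) c x) ⟩
  (invM c *M c) *M x ≡⟨ cong (_*M x) (*M-inverseˡ c sc) ⟩
  IM *M x            ≡⟨ *M-identityˡ x ⟩
  x                  ∎
  where open ≡-Reasoning

*M-invM-cancelˡ : ∀ c x → SL c → c *M (invM c *M x) ≡ x
*M-invM-cancelˡ c x sc = begin
  c *M (invM c *M x) ≡⟨ sym (*M-assoc c (invM c) x) ⟩
  (c *M invM c) *M x ≡⟨ cong (_*M x) (*M-inverseʳ c sc) ⟩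
  IM *M x            ≡⟨ *M-identityˡ x ⟩
  x                  ∎
  where open ≡-Reasoning

idempotent⇒≈P-IM : ∀ p → SL p → p ≈P (p *M p) → p ≈P IM
idempotent⇒≈P-IM p sp p≈p² = ≈P-sym (begin
  IM                 ≡⟨ sym (*M-inverseˡ p sp) ⟩
  invM p *M p        ≈⟨ ≈P-*M (≈P-refl {invM p}) p≈p² ⟩
  invM p *M (p *M p) ≡⟨ invM-*M-cancelˡ p p sp ⟩
  p                  ∎)
  where open ≈P-Reasoning

conj : Mat → Mat → Mat
conj c x = (c *M x) *M invM c

SL-conj : ∀ c x → SL c → SL x → SL (conj c x)
SL-conj c x sc sx = SL-*M (c *M x) (invM c) (SL-*M c x sc sx) (SL-invM c sc)

conj-*M : ∀ c x y → SL c → conj c (x *M y) ≡ conj c x *M conj c y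
conj-*M c x y sc = sym (begin
  ((c *M x) *M invM c) *M ((c *M y) *M invM c) ≡⟨ cong (((c *M x) *M invM c) *M_) (*M-assoc c y (invM c)) ⟩
  ((c *M x) *M invM c) *M (c *M (y *M invM c)) ≡⟨ *M-cancel-invM-middle (c *M x) c (y *M invM c) sc ⟩
  (c *M x) *M (y *M invM c)                    ≡⟨ sym (*M-assoc (c *M x) y (invM c)) ⟩
  ((c *M x) *M y) *M invM c                    ≡⟨ cong (_*M invM c) (*M-assoc c x y) ⟩
  (c *M (x *M y)) *M invM c                    ∎)
  where open ≡-Reasoning

conj-*M-conj : ∀ c d x → conj (c *M d) x ≡ conj c (conj d x)
conj-*M-conj c d x = begin
  ((c *M d) *M x) *M invM (c *M d)         ≡⟨ cong (((c *M d) *M x) *M_) (invM-anti-homo-*M c d) ⟩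
  ((c *M d) *M x) *M (invM d *M invM c)    ≡⟨ sym (*M-assoc ((c *M d) *M x) (invM d) (invM c)) ⟩
  (((c *M d) *M x) *M invM d) *M invM c    ≡⟨ cong (λ u → (u *M invM d) *M invM c) (*M-assoc c d x) ⟩
  ((c *M (d *M x)) *M invM d) *M invM c    ≡⟨ cong (_*M invM c) (*M-assoc c (d *M x) (invM d)) ⟩
  (c *M ((d *M x) *M invM d)) *M invM c    ∎
  where open ≡-Reasoning

conj-IM : ∀ c → SL c → conj c IM ≡ IM
conj-IM c sc = trans (cong (_*M invM c) (*M-identityʳ c)) (*M-inverseʳ c sc)

conj-invM-conj : ∀ c x → SL c → conj (invM c) (conj c x) ≡ x
conj-invM-conj c x sc = begin
  conj (invM c) (conj c x) ≡⟨ sym (conj-*M-conj (invM c) c x) ⟩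
  conj (invM c *M c) x     ≡⟨ cong (λ u → conj u x) (*M-inverseˡ c sc) ⟩
  (IM *M x) *M IM          ≡⟨ *M-identityʳ (IM *M x) ⟩
  IM *M x                  ≡⟨ *M-identityˡ x ⟩
  x                        ∎
  where open ≡-Reasoning

conj-≈P : ∀ c {x y} → x ≈P y → conj c x ≈P conj c y
conj-≈P c x≈y = ≈P-*M (≈P-*M (≈P-refl {c}) x≈y) (≈P-refl {invM c})

conj-≈P-cancel : ∀ c {x y} → SL c → conj c x ≈P conj c y → x ≈P y
conj-≈P-cancel c {x} {y} sc cx≈cy = begin
  x                        ≡⟨ sym (conj-invM-conj c x sc) ⟩
  conj (invM c) (conj c x) ≈⟨ conj-≈P (invM c) cx≈cy ⟩
  conj (invM c) (conj c y) ≡⟨ conj-invM-conj c y sc ⟩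
  y                        ∎
  where open ≈P-Reasoning

module _ {H : Mat → Set} (isSubgroup : IsPSLSubgroup H) where
  open IsPSLSubgroup isSubgroup

  ≡⇒SameCoset : ∀ {x y} → SL x → x ≡ y → SameCoset H x y
  ≡⇒SameCoset {x} sx refl = subst H (sym (*M-inverseʳ x sx)) hasId

  ∈⇒SameCoset-IM : ∀ {h} → H h → SameCoset H (IM *M h) IM
  ∈⇒SameCoset-IM {h} h∈H = subst H (sym (trans (*M-identityˡ (invM (IM *M h))) (cong invM (*M-identityˡ h))))
                                    (invClosed h h∈H)

module _ {H : Mat → Set} {O : Mat → Mat → Bool} (G : IsGenOrbitalGraph H O) where
  open IsGenOrbitalGraph G

  O-translate : ∀ {x y u w} g → SL x → SL y → SL g → SL u → SL w → O x y ≡ true →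
                SameCoset H (x *M g) u → SameCoset H (y *M g) w → O u w ≡ true
  O-translate {x} {y} {u} {w} g sx sy sg su sw e hu hw =
    trans (sym (wellDef (x *M g) u (y *M g) w (SL-*M x g sx sg) su (SL-*M y g sy sg) sw hu hw))
          (unionOrb x y g sx sy sg e)

  O-orbital-edge : ∀ {s g u w} → SL s → SL g → SL u → SL w → O IM s ≡ true →
    SameCoset H (IM *M g) u × SameCoset H (s *M g) w ⊎ SameCoset H (s *M g) u × SameCoset H (IM *M g) w →
    O u w ≡ true
  O-orbital-edge {g = g} ss sg su sw e (inj₁ (hu , hw)) = O-translate g refl ss sg su sw e hu hw
  O-orbital-edge {g = g} {u} {w} ss sg su sw e (inj₂ (hu , hw)) =
    trans (symm u w su sw) (O-translate g refl ss sg sw su e hw hu)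

-- Conjugate subgroups

module ConjugateCosets {H H' : Mat → Set} (c : Mat) (sc : SL c)
                       (H⇔H' : ∀ m → H m ⇔ H' (conj c m)) where

  conj-quotient : ∀ x y → conj c (y *M invM x) ≡ (c *M y) *M invM (c *M x)
  conj-quotient x y = begin
    (c *M (y *M invM x)) *M invM c ≡⟨ cong (_*M invM c) (sym (*M-assoc c y (invM x))) ⟩
    ((c *M y) *M invM x) *M invM c ≡⟨ *M-assoc (c *M y) (invM x) (invM c) ⟩
    (c *M y) *M (invM x *M invM c) ≡⟨ cong ((c *M y) *M_) (sym (invM-anti-homo-*M c x)) ⟩
    (c *M y) *M invM (c *M x)      ∎
    where open ≡-Reasoning

  SameCoset-c*M : ∀ x y → SameCoset H x y ⇔ SameCoset H' (c *M x) (c *M y)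
  SameCoset-c*M x y = mk⇔
    (subst H' (conj-quotient x y) ∘ to (H⇔H' (y *M invM x)))
    (from (H⇔H' (y *M invM x)) ∘ subst H' (sym (conj-quotient x y)))

  c⁻¹* : Mat → Mat
  c⁻¹* x = invM c *M x

  SL-c⁻¹* : ∀ x → SL x → SL (c⁻¹* x)
  SL-c⁻¹* x = SL-*M (invM c) x (SL-invM c sc)

  SameCoset-c⁻¹* : ∀ x y → SameCoset H (c⁻¹* x) (c⁻¹* y) ⇔ SameCoset H' x y
  SameCoset-c⁻¹* x y = mk⇔
    (subst₂ (SameCoset H') (*M-invM-cancelˡ c x sc) (*M-invM-cancelˡ c y sc) ∘ to equiv)
    (from equiv ∘ subst₂ (SameCoset H') (sym (*M-invM-cancelˡ c x sc)) (sym (*M-invM-cancelˡ c y sc)))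
    where
    equiv = SameCoset-c*M (c⁻¹* x) (c⁻¹* y)

  pullback : (Mat → Mat → Bool) → Mat → Mat → Bool
  pullback O x y = O (c⁻¹* x) (c⁻¹* y)

  pullback-isGenOrbitalGraph : ∀ {O} → IsGenOrbitalGraph H O → IsGenOrbitalGraph H' (pullback O)
  pullback-isGenOrbitalGraph {O} G = record
    { wellDef  = λ x x' y y' sx sx' sy sy' hx hy →
        wellDef (c⁻¹* x) (c⁻¹* x') (c⁻¹* y) (c⁻¹* y')
          (SL-c⁻¹* x sx) (SL-c⁻¹* x' sx') (SL-c⁻¹* y sy) (SL-c⁻¹* y' sy')
          (from (SameCoset-c⁻¹* x x') hx) (from (SameCoset-c⁻¹* y y') hy)
    ; unionOrb = λ x y g sx sy sg e →
        subst₂ (λ u w → O u w ≡ true) (*M-assoc (invM c) x g) (*M-assoc (invM c) y g)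
          (unionOrb (c⁻¹* x) (c⁻¹* y) g (SL-c⁻¹* x sx) (SL-c⁻¹* y sy) sg e)
    ; noDiag   = λ x sx → noDiag (c⁻¹* x) (SL-c⁻¹* x sx)
    ; symm     = λ x y sx sy → symm (c⁻¹* x) (c⁻¹* y) (SL-c⁻¹* x sx) (SL-c⁻¹* y sy)
    ; nonempty =
        let x , y , sx , sy , e = nonempty
        in c *M x , c *M y , SL-*M c x sc sx , SL-*M c y sc sy ,
           subst₂ (λ u w → O u w ≡ true) (sym (invM-*M-cancelˡ c x sc)) (sym (invM-*M-cancelˡ c y sc)) e
    }
    where open IsGenOrbitalGraph G

  pullback-hamiltonCycle : ∀ {O} → HasHamiltonCycle H' (pullback O) → HasHamiltonCycle H O
  pullback-hamiltonCycle {O} (n , v , SL-v , distinct , covers , edges) =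
    n , c⁻¹* ∘ v , (λ i → SL-c⁻¹* (v i) (SL-v i)) , distinct' , covers' , edges
    where
    distinct' : ∀ i j → SameCoset H (c⁻¹* (v i)) (c⁻¹* (v j)) → i ≡ j
    distinct' i j = distinct i j ∘ to (SameCoset-c⁻¹* (v i) (v j))

    covers' : ∀ x → SL x → ∃[ i ] SameCoset H x (c⁻¹* (v i))
    covers' x sx =
      let i , h = covers (c *M x) (SL-*M c x sc sx)
      in i , subst (λ u → SameCoset H u (c⁻¹* (v i))) (invM-*M-cancelˡ c x sc)
               (from (SameCoset-c⁻¹* (c *M x) (v i)) h)

-- A model of 2×2 matrices over ℕ for exhaustive checks

data NMat : Set where
  nm : ℕ → ℕ → ℕ → ℕ → NMat

_+₁₃_ _*₁₃_ : ℕ → ℕ → ℕ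
m +₁₃ n = (m + n) % 13
m *₁₃ n = (m * n) % 13

-₁₃_ : ℕ → ℕ
-₁₃ n = (13 ∸ n) % 13

_*ᴺ_ : NMat → NMat → NMat
nm a b c d *ᴺ nm a' b' c' d' =
  nm ((a *₁₃ a') +₁₃ (b *₁₃ c')) ((a *₁₃ b') +₁₃ (b *₁₃ d'))
     ((c *₁₃ a') +₁₃ (d *₁₃ c')) ((c *₁₃ b') +₁₃ (d *₁₃ d'))

invᴺ negᴺ : NMat → NMat
invᴺ (nm a b c d) = nm d (-₁₃ b) (-₁₃ c) a
negᴺ (nm a b c d) = nm (-₁₃ a) (-₁₃ b) (-₁₃ c) (-₁₃ d)

detᴺ : NMat → ℕ
detᴺ (nm a b c d) = (a *₁₃ d) +₁₃ (-₁₃ (b *₁₃ c))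

isSLᴺ : NMat → Bool
isSLᴺ n = detᴺ n ≡ᵇ 1

_≡ᴺ_ _≈ᴺ_ : NMat → NMat → Bool
nm a b c d ≡ᴺ nm a' b' c' d' = (a ≡ᵇ a') ∧ ((b ≡ᵇ b') ∧ ((c ≡ᵇ c') ∧ (d ≡ᵇ d')))
m ≈ᴺ n = (m ≡ᴺ n) ∨ (m ≡ᴺ negᴺ n)

toN : Mat → NMat
toN (mat a b c d) = nm (toℕ a) (toℕ b) (toℕ c) (toℕ d)

fromN : NMat → Mat
fromN (nm a b c d) = mat (a mod 13) (b mod 13) (c mod 13) (d mod 13)

isReducedᴺ : NMat → Bool
isReducedᴺ (nm a b c d) = (a <ᵇ 13) ∧ ((b <ᵇ 13) ∧ ((c <ᵇ 13) ∧ (d <ᵇ 13)))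

nm-cong : ∀ {a b c d a' b' c' d'} → a ≡ a' → b ≡ b' → c ≡ c' → d ≡ d' →
          nm a b c d ≡ nm a' b' c' d'
nm-cong refl refl refl refl = refl

≡ᴺ-sound : ∀ m n → m ≡ᴺ n ≡ true → m ≡ n
≡ᴺ-sound (nm a b c d) (nm a' b' c' d') p =
  let pa , p₁ = ∧-split {a ≡ᵇ a'} p
      pb , p₂ = ∧-split {b ≡ᵇ b'} p₁
      pc , pd = ∧-split {c ≡ᵇ c'} p₂
  in nm-cong (≡ᵇ-sound a a' pa) (≡ᵇ-sound b b' pb) (≡ᵇ-sound c c' pc) (≡ᵇ-sound d d' pd)

≡ᴺ-refl : ∀ n → n ≡ᴺ n ≡ true
≡ᴺ-refl (nm a b c d) =
  ∧-intro (≡ᵇ-complete a a refl) (∧-intro (≡ᵇ-complete b b refl) (∧-intro (≡ᵇ-complete c c refl) (≡ᵇ-complete d d refl)))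

nm-injective : ∀ {a b c d a' b' c' d'} → nm a b c d ≡ nm a' b' c' d' →
               a ≡ a' × b ≡ b' × c ≡ c' × d ≡ d'
nm-injective refl = refl , refl , refl , refl

toN-injective : ∀ {x y} → toN x ≡ toN y → x ≡ y
toN-injective eq =
  let ea , eb , ec , ed = nm-injective eq
  in mat-cong (toℕ-injective ea) (toℕ-injective eb) (toℕ-injective ec) (toℕ-injective ed)

toN-fromN : ∀ n → isReducedᴺ n ≡ true → toN (fromN n) ≡ n
toN-fromN (nm a b c d) p =
  let pa , p₁ = ∧-split {a <ᵇ 13} p
      pb , p₂ = ∧-split {b <ᵇ 13} p₁
      pc , pd = ∧-split {c <ᵇ 13} p₂
  in nm-cong (reduce a pa) (reduce b pb) (reduce c pc) (reduce d pd)
  where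
  reduce : ∀ a → (a <ᵇ 13) ≡ true → toℕ (a mod 13) ≡ a
  reduce a p = trans (toℕ-fromℕ< _) (m<n⇒m%n≡m (<ᵇ⇒< a 13 (from T-≡ p)))

toℕ-+F : ∀ u v → toℕ (u +F v) ≡ toℕ u +₁₃ toℕ v
toℕ-+F u v = toℕ-fromℕ< _

toℕ-*F : ∀ u v → toℕ (u *F v) ≡ toℕ u *₁₃ toℕ v
toℕ-*F u v = toℕ-fromℕ< _

toℕ--F : ∀ u → toℕ (-F u) ≡ -₁₃ toℕ u
toℕ--F u = toℕ-fromℕ< _

toℕ-dot : ∀ p q r s → toℕ ((p *F q) +F (r *F s)) ≡ (toℕ p *₁₃ toℕ q) +₁₃ (toℕ r *₁₃ toℕ s)
toℕ-dot p q r s = trans (toℕ-+F (p *F q) (r *F s)) (cong₂ _+₁₃_ (toℕ-*F p q) (toℕ-*F r s))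

toN-*M : ∀ x y → toN (x *M y) ≡ toN x *ᴺ toN y
toN-*M (mat a b c d) (mat a' b' c' d') =
  nm-cong (toℕ-dot a a' b c') (toℕ-dot a b' b d') (toℕ-dot c a' d c') (toℕ-dot c b' d d')

toN-invM : ∀ x → toN (invM x) ≡ invᴺ (toN x)
toN-invM (mat a b c d) = nm-cong refl (toℕ--F b) (toℕ--F c) refl

toN-negM : ∀ x → toN (negM x) ≡ negᴺ (toN x)
toN-negM (mat a b c d) = nm-cong (toℕ--F a) (toℕ--F b) (toℕ--F c) (toℕ--F d)

toℕ-det : ∀ x → toℕ (det x) ≡ detᴺ (toN x)
toℕ-det (mat a b c d) =
  trans (toℕ-+F (a *F d) (-F (b *F c)))
        (cong₂ _+₁₃_ (toℕ-*F a d) (trans (toℕ--F (b *F c)) (cong -₁₃_ (toℕ-*F b c))))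

isSLᴺ-sound : ∀ x → isSLᴺ (toN x) ≡ true → SL x
isSLᴺ-sound x p = toℕ-injective (trans (toℕ-det x) (≡ᵇ-sound _ 1 p))

isSLᴺ-complete : ∀ x → SL x → isSLᴺ (toN x) ≡ true
isSLᴺ-complete x sx = subst (λ n → (n ≡ᵇ 1) ≡ true) (trans (cong toℕ (sym sx)) (toℕ-det x)) refl

≈ᴺ-sound : ∀ x y → toN x ≈ᴺ toN y ≡ true → x ≈P y
≈ᴺ-sound x y p with ∨-split {toN x ≡ᴺ toN y} p
... | inj₁ q = inj₁ (toN-injective (≡ᴺ-sound _ _ q))
... | inj₂ q = inj₂ (toN-injective (trans (≡ᴺ-sound _ _ q) (sym (toN-negM y))))

≈ᴺ-complete : ∀ x y → x ≈P y → toN x ≈ᴺ toN y ≡ true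
≈ᴺ-complete x .x (inj₁ refl) = ∨-introˡ (≡ᴺ-refl (toN x))
≈ᴺ-complete .(negM y) y (inj₂ refl) =
  ∨-introʳ {toN (negM y) ≡ᴺ toN y} (subst (λ n → n ≡ᴺ negᴺ (toN y) ≡ true) (sym (toN-negM y)) (≡ᴺ-refl (negᴺ (toN y))))

allMat : (Mat → Bool) → Bool
allMat p = allF λ a → allF λ b → allF λ c → allF λ d → p (mat a b c d)

allMat-sound : ∀ p → allMat p ≡ true → ∀ x → p x ≡ true
allMat-sound p h (mat a b c d) =
  allFinᵇ-sound 13 (λ d → p (mat a b c d))
    (allFinᵇ-sound 13 (λ c → allF λ d → p (mat a b c d))
      (allFinᵇ-sound 13 (λ b → allF λ c → allF λ d → p (mat a b c d))
        (allFinᵇ-sound 13 (λ a → allF λ b → allF λ c → allF λ d → p (mat a b c d)) h a) b) c) d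

-- The reference subgroup H₀ and its cosets

H₀-table : Vec NMat 12
H₀-table =
  nm 0 4 3 0 ∷ nm 0 6 2 0 ∷ nm 1 0 0 1 ∷ nm 2 1 6 10 ∷ nm 2 5 9 10 ∷ nm 2 8 4 10 ∷ nm 2 12 7 10 ∷
  nm 3 1 6 11 ∷ nm 3 5 9 11 ∷ nm 3 8 4 11 ∷ nm 3 12 7 11 ∷ nm 5 0 0 8 ∷ []

isH₀ᴺ : NMat → Bool
isH₀ᴺ n = anyᵇ (n ≈ᴺ_) H₀-table

-- A record, so that H₀ m is not unfolded into its membership test during unification.
record H₀ (m : Mat) : Set where
  constructor mkH₀
  field H₀-listed : isH₀ᴺ (toN m) ≡ true
open H₀ public

H₀-intro : ∀ {m n} → toN m ≡ n → isH₀ᴺ n ≡ true → H₀ m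
H₀-intro refl p = mkH₀ p

H₀-elim : ∀ {m n} → toN m ≡ n → H₀ m → isH₀ᴺ n ≡ true
H₀-elim refl h = H₀-listed h

H₀-element : Fin 12 → Mat
H₀-element = fromN ∘ lookup H₀-table

toN-H₀-element : ∀ i → toN (H₀-element i) ≡ lookup H₀-table i
toN-H₀-element i =
  toN-fromN _ (allᵇ-sound isReducedᴺ H₀-table refl i)

H₀-elements : ∀ m → H₀ m → ∃[ i ] m ≈P H₀-element i
H₀-elements m h =
  let i , p = anyᵇ-sound (toN m ≈ᴺ_) H₀-table (H₀-listed h)
  in i , ≈ᴺ-sound m (H₀-element i) (subst (λ n → toN m ≈ᴺ n ≡ true) (sym (toN-H₀-element i)) p)

H₀-element-∈ : ∀ {m} i → m ≈P H₀-element i → H₀ m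
H₀-element-∈ {m} i m≈h = mkH₀ $ anyᵇ-complete (toN m ≈ᴺ_) H₀-table i
  (subst (λ n → toN m ≈ᴺ n ≡ true) (toN-H₀-element i) (≈ᴺ-complete m (H₀-element i) m≈h))

H₀-resp : ∀ x y → x ≈P y → H₀ x → H₀ y
H₀-resp x y x≈y h = let i , p = H₀-elements x h in H₀-element-∈ i (≈P-trans (≈P-sym x≈y) p)

H₀-⊆SL : ∀ m → H₀ m → SL m
H₀-⊆SL m h = let i , p = H₀-elements m h in
  SL-≈P {m} {H₀-element i} p (isSLᴺ-sound (H₀-element i) (allFinᵇ-sound 12 (isSLᴺ ∘ toN ∘ H₀-element) refl i))

H₀-*M-closed : ∀ x y → H₀ x → H₀ y → H₀ (x *M y)
H₀-*M-closed x y hx hy =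
  let i , p = H₀-elements x hx
      j , q = H₀-elements y hy
  in H₀-resp _ _ (≈P-sym (≈P-*M p q))
       (mkH₀ $ allFinᵇ-sound 12 (λ j → isH₀ᴺ (toN (H₀-element i *M H₀-element j)))
         (allFinᵇ-sound 12 (λ i → allFinᵇ 12 λ j → isH₀ᴺ (toN (H₀-element i *M H₀-element j))) refl i) j)

H₀-invM-closed : ∀ x → H₀ x → H₀ (invM x)
H₀-invM-closed x h =
  let i , p = H₀-elements x h
  in H₀-resp _ _ (≈P-sym (≈P-invM p)) (mkH₀ $ allFinᵇ-sound 12 (λ i → isH₀ᴺ (toN (invM (H₀-element i)))) refl i)

H₀-isPSLSubgroup : IsPSLSubgroup H₀
H₀-isPSLSubgroup = record
  { ⊆SL = H₀-⊆SL ; resp = H₀-resp ; hasId = mkH₀ refl ; mulClosed = H₀-*M-closed ; invClosed = H₀-invM-closed }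

coset-table : Vec NMat 91
coset-table =
  nm 1 0 0 1 ∷ nm 0 1 12 0 ∷ nm 0 1 12 1 ∷ nm 0 1 12 2 ∷ nm 0 1 12 3 ∷ nm 0 1 12 4 ∷
  nm 0 1 12 5 ∷ nm 0 1 12 6 ∷ nm 0 1 12 7 ∷ nm 0 1 12 8 ∷ nm 0 1 12 9 ∷ nm 0 1 12 10 ∷
  nm 0 1 12 11 ∷ nm 0 1 12 12 ∷ nm 0 2 6 0 ∷ nm 0 2 6 1 ∷ nm 0 2 6 2 ∷ nm 0 2 6 3 ∷ nm 0 2 6 4 ∷
  nm 0 2 6 5 ∷ nm 0 2 6 6 ∷ nm 0 2 6 7 ∷ nm 0 2 6 8 ∷ nm 0 2 6 9 ∷ nm 0 2 6 10 ∷ nm 0 2 6 11 ∷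
  nm 0 2 6 12 ∷ nm 0 4 3 1 ∷ nm 0 4 3 2 ∷ nm 0 4 3 3 ∷ nm 0 4 3 4 ∷ nm 0 4 3 5 ∷ nm 0 4 3 6 ∷
  nm 0 4 3 7 ∷ nm 0 4 3 8 ∷ nm 0 4 3 9 ∷ nm 0 4 3 10 ∷ nm 0 4 3 11 ∷ nm 0 4 3 12 ∷ nm 1 0 1 1 ∷
  nm 1 0 4 1 ∷ nm 1 0 5 1 ∷ nm 1 0 6 1 ∷ nm 1 0 7 1 ∷ nm 1 0 8 1 ∷ nm 1 0 9 1 ∷ nm 1 0 12 1 ∷
  nm 1 1 4 5 ∷ nm 1 1 5 6 ∷ nm 1 1 6 7 ∷ nm 1 1 7 8 ∷ nm 1 1 8 9 ∷ nm 1 1 12 0 ∷ nm 1 2 4 9 ∷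
  nm 1 2 5 11 ∷ nm 1 2 6 0 ∷ nm 1 2 7 2 ∷ nm 1 2 8 4 ∷ nm 1 2 12 12 ∷ nm 1 3 4 0 ∷ nm 1 3 5 3 ∷
  nm 1 3 6 6 ∷ nm 1 3 7 9 ∷ nm 1 3 8 12 ∷ nm 1 3 12 11 ∷ nm 1 4 4 4 ∷ nm 1 4 5 8 ∷ nm 1 4 6 12 ∷
  nm 1 4 7 3 ∷ nm 1 4 8 7 ∷ nm 1 4 12 10 ∷ nm 1 5 4 8 ∷ nm 1 5 5 0 ∷ nm 1 5 6 5 ∷ nm 1 5 12 9 ∷
  nm 1 6 4 12 ∷ nm 1 6 5 5 ∷ nm 1 6 6 11 ∷ nm 1 6 12 8 ∷ nm 1 7 4 3 ∷ nm 1 7 5 10 ∷ nm 1 7 6 4 ∷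
  nm 1 7 12 7 ∷ nm 1 8 4 7 ∷ nm 1 8 12 6 ∷ nm 1 9 4 11 ∷ nm 1 9 12 5 ∷ nm 1 10 4 2 ∷
  nm 1 10 12 4 ∷ nm 1 11 4 6 ∷ nm 1 11 12 3 ∷ []

coset : Fin 91 → Mat
coset = fromN ∘ lookup coset-table

toN-coset : ∀ k → toN (coset k) ≡ lookup coset-table k
toN-coset k = toN-fromN _ (allᵇ-sound isReducedᴺ coset-table refl k)

toN-coset-*M-invM : ∀ k x → toN (coset k *M invM x) ≡ lookup coset-table k *ᴺ invᴺ (toN x)
toN-coset-*M-invM k x = trans (toN-*M (coset k) (invM x)) (cong₂ _*ᴺ_ (toN-coset k) (toN-invM x))

SL-coset : ∀ k → SL (coset k)
SL-coset k = isSLᴺ-sound (coset k) (allFinᵇ-sound 91 (isSLᴺ ∘ toN ∘ coset) refl k)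

coversᴺ : NMat → Bool
coversᴺ n = not (isSLᴺ n) ∨ anyᵇ (λ r → isH₀ᴺ (r *ᴺ invᴺ n)) coset-table

coset-cover : ∀ x → SL x → ∃[ k ] SameCoset H₀ x (coset k)
coset-cover x sx =
  let k , p = anyᵇ-sound (λ r → isH₀ᴺ (r *ᴺ invᴺ (toN x))) coset-table
                (implies-elim (allMat-sound (coversᴺ ∘ toN) refl x) (isSLᴺ-complete x sx))
  in k , H₀-intro (toN-coset-*M-invM k x) p

distinctᴺ : NMat → NMat → Bool
distinctᴺ r r' = not (isH₀ᴺ (r' *ᴺ invᴺ r))

coset-distinct : ∀ k k' → SameCoset H₀ (coset k) (coset k') → k ≡ k'
coset-distinct k k' h = ≡ᶠᵇ-sound k k' (implies-elim
  (allFinᵇ-sound 91 (λ k' → distinctᴺ (lookup coset-table k) (lookup coset-table k') ∨ (k ≡ᶠᵇ k'))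
    (allFinᵇ-sound 91 (λ k → allFinᵇ 91 λ k' →
        distinctᴺ (lookup coset-table k) (lookup coset-table k') ∨ (k ≡ᶠᵇ k')) refl k) k')
  (H₀-elim (trans (toN-coset-*M-invM k' (coset k)) (cong (λ n → lookup coset-table k' *ᴺ invᴺ n) (toN-coset k))) h))

suborbit-rep : Vec (Fin 91) 10
suborbit-rep =
  # 1 ∷ # 2 ∷ # 3 ∷ # 4 ∷ # 5 ∷ # 6 ∷ # 28 ∷ # 30 ∷ # 32 ∷ # 47 ∷ []

suborbit-of : Vec (Fin 10) 91
suborbit-of =
  # 0 ∷ # 0 ∷ # 1 ∷ # 2 ∷ # 3 ∷ # 4 ∷ # 5 ∷ # 4 ∷ # 4 ∷ # 5 ∷ # 4 ∷ # 3 ∷ # 2 ∷ # 1 ∷ # 0 ∷ # 1 ∷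
  # 3 ∷ # 2 ∷ # 4 ∷ # 5 ∷ # 4 ∷ # 4 ∷ # 5 ∷ # 4 ∷ # 2 ∷ # 3 ∷ # 1 ∷ # 2 ∷ # 6 ∷ # 6 ∷ # 7 ∷ # 3 ∷
  # 8 ∷ # 8 ∷ # 3 ∷ # 7 ∷ # 6 ∷ # 6 ∷ # 2 ∷ # 7 ∷ # 6 ∷ # 8 ∷ # 6 ∷ # 6 ∷ # 8 ∷ # 6 ∷ # 7 ∷ # 9 ∷
  # 1 ∷ # 1 ∷ # 0 ∷ # 3 ∷ # 5 ∷ # 3 ∷ # 2 ∷ # 5 ∷ # 6 ∷ # 2 ∷ # 6 ∷ # 1 ∷ # 9 ∷ # 1 ∷ # 2 ∷ # 6 ∷
  # 3 ∷ # 5 ∷ # 4 ∷ # 4 ∷ # 3 ∷ # 0 ∷ # 5 ∷ # 0 ∷ # 1 ∷ # 9 ∷ # 2 ∷ # 4 ∷ # 5 ∷ # 2 ∷ # 4 ∷ # 2 ∷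
  # 1 ∷ # 1 ∷ # 0 ∷ # 5 ∷ # 5 ∷ # 3 ∷ # 1 ∷ # 6 ∷ # 3 ∷ # 5 ∷ # 9 ∷ []

suborbit-witness : Vec (Fin 12) 91
suborbit-witness =
  # 2 ∷ # 2 ∷ # 2 ∷ # 2 ∷ # 2 ∷ # 2 ∷ # 2 ∷ # 10 ∷ # 5 ∷ # 11 ∷ # 11 ∷ # 11 ∷ # 11 ∷ # 11 ∷ # 0 ∷
  # 5 ∷ # 8 ∷ # 5 ∷ # 8 ∷ # 3 ∷ # 9 ∷ # 3 ∷ # 9 ∷ # 6 ∷ # 10 ∷ # 6 ∷ # 10 ∷ # 1 ∷ # 2 ∷ # 10 ∷
  # 2 ∷ # 1 ∷ # 2 ∷ # 3 ∷ # 0 ∷ # 4 ∷ # 5 ∷ # 11 ∷ # 0 ∷ # 0 ∷ # 4 ∷ # 1 ∷ # 1 ∷ # 0 ∷ # 0 ∷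
  # 7 ∷ # 1 ∷ # 2 ∷ # 9 ∷ # 8 ∷ # 3 ∷ # 7 ∷ # 8 ∷ # 3 ∷ # 3 ∷ # 1 ∷ # 8 ∷ # 4 ∷ # 9 ∷ # 0 ∷ # 0 ∷
  # 7 ∷ # 7 ∷ # 6 ∷ # 5 ∷ # 7 ∷ # 7 ∷ # 4 ∷ # 4 ∷ # 6 ∷ # 10 ∷ # 4 ∷ # 4 ∷ # 1 ∷ # 8 ∷ # 0 ∷
  # 0 ∷ # 9 ∷ # 1 ∷ # 6 ∷ # 6 ∷ # 3 ∷ # 5 ∷ # 5 ∷ # 4 ∷ # 10 ∷ # 1 ∷ # 3 ∷ # 9 ∷ # 6 ∷ # 3 ∷ []

suborbit-rep-coset : Fin 10 → Mat
suborbit-rep-coset = coset ∘ lookup suborbit-rep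

reaches-suborbit-repᵇ : Fin 91 → Bool
reaches-suborbit-repᵇ k = isH₀ᴺ (toN (suborbit-rep-coset (lookup suborbit-of k)
                                       *M invM (coset k *M H₀-element (lookup suborbit-witness k))))

reaches-suborbit-rep : ∀ k → SameCoset H₀ (coset (suc k) *M H₀-element (lookup suborbit-witness (suc k)))
                                          (suborbit-rep-coset (lookup suborbit-of (suc k)))
reaches-suborbit-rep k = mkH₀ (allFinᵇ-sound 90 (reaches-suborbit-repᵇ ∘ suc) refl k)

module _ {O : Mat → Mat → Bool} (G : IsGenOrbitalGraph H₀ O) where
  open IsGenOrbitalGraph G

  edge-from-IM : ∀ {x y} → SL x → SL y → O x y ≡ true → ∃[ k ] O IM (coset k) ≡ true
  edge-from-IM {x} {y} sx sy e =
    let k , hk = coset-cover (y *M invM x) (SL-*M y (invM x) sy (SL-invM x sx))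
    in k , O-translate G (invM x) sx sy (SL-invM x sx) refl (SL-coset k) e
             (≡⇒SameCoset H₀-isPSLSubgroup (SL-*M x (invM x) sx (SL-invM x sx)) (*M-inverseʳ x sx)) hk

  suborbit-edge : ∀ {k} → O IM (coset k) ≡ true → ∃[ j ] O IM (suborbit-rep-coset j) ≡ true
  -- coset zero is IM on the nose
  suborbit-edge {zero} e₀ = ⊥-elim (true≢false (trans (sym e₀) (noDiag IM refl)))
    where
    true≢false : true ≢ false
    true≢false ()
  suborbit-edge {suc k} eₖ =
    lookup suborbit-of (suc k) ,
    O-translate G h refl (SL-coset (suc k))
      (H₀-⊆SL h h∈H₀) refl (SL-coset (lookup suborbit-rep (lookup suborbit-of (suc k))))
      eₖ (∈⇒SameCoset-IM H₀-isPSLSubgroup h∈H₀) (reaches-suborbit-rep k)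
    where
    h = H₀-element (lookup suborbit-witness (suc k))
    h∈H₀ : H₀ h
    h∈H₀ = H₀-element-∈ (lookup suborbit-witness (suc k)) ≈P-refl

  edge-to-suborbit-rep : ∃[ j ] O IM (suborbit-rep-coset j) ≡ true
  edge-to-suborbit-rep =
    let x , y , sx , sy , e = nonempty
        k , eₖ = edge-from-IM sx sy e
    in suborbit-edge {k} eₖ

-- Hamilton cycles for H₀

cycle-table : Vec (Vec (Fin 91) 91) 10
cycle-table =
  ( # 0 ∷ # 69 ∷ # 50 ∷ # 26 ∷ # 61 ∷ # 5 ∷ # 56 ∷ # 29 ∷ # 84 ∷ # 65 ∷ # 1 ∷ # 14 ∷ # 80 ∷
      # 42 ∷ # 76 ∷ # 21 ∷ # 2 ∷ # 41 ∷ # 77 ∷ # 18 ∷ # 28 ∷ # 9 ∷ # 46 ∷ # 85 ∷ # 90 ∷ # 38 ∷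
      # 25 ∷ # 73 ∷ # 54 ∷ # 23 ∷ # 59 ∷ # 74 ∷ # 33 ∷ # 15 ∷ # 72 ∷ # 27 ∷ # 47 ∷ # 88 ∷ # 75 ∷
      # 12 ∷ # 51 ∷ # 60 ∷ # 16 ∷ # 57 ∷ # 11 ∷ # 66 ∷ # 37 ∷ # 58 ∷ # 40 ∷ # 86 ∷ # 79 ∷ # 32 ∷
      # 49 ∷ # 7 ∷ # 43 ∷ # 36 ∷ # 78 ∷ # 87 ∷ # 8 ∷ # 52 ∷ # 22 ∷ # 63 ∷ # 10 ∷ # 45 ∷ # 83 ∷
      # 35 ∷ # 68 ∷ # 3 ∷ # 53 ∷ # 70 ∷ # 30 ∷ # 4 ∷ # 62 ∷ # 67 ∷ # 19 ∷ # 82 ∷ # 89 ∷ # 31 ∷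
      # 24 ∷ # 81 ∷ # 48 ∷ # 44 ∷ # 17 ∷ # 34 ∷ # 39 ∷ # 64 ∷ # 6 ∷ # 55 ∷ # 20 ∷ # 13 ∷ # 71 ∷ [] )
  ∷ ( # 0 ∷ # 70 ∷ # 61 ∷ # 19 ∷ # 2 ∷ # 42 ∷ # 24 ∷ # 48 ∷ # 90 ∷ # 9 ∷ # 87 ∷ # 65 ∷ # 31 ∷
      # 80 ∷ # 3 ∷ # 74 ∷ # 62 ∷ # 7 ∷ # 37 ∷ # 41 ∷ # 82 ∷ # 86 ∷ # 11 ∷ # 32 ∷ # 18 ∷ # 58 ∷
      # 88 ∷ # 68 ∷ # 78 ∷ # 15 ∷ # 50 ∷ # 64 ∷ # 5 ∷ # 47 ∷ # 85 ∷ # 16 ∷ # 12 ∷ # 35 ∷ # 14 ∷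
      # 57 ∷ # 46 ∷ # 84 ∷ # 81 ∷ # 28 ∷ # 56 ∷ # 76 ∷ # 53 ∷ # 26 ∷ # 36 ∷ # 79 ∷ # 38 ∷ # 77 ∷
      # 55 ∷ # 83 ∷ # 40 ∷ # 75 ∷ # 1 ∷ # 69 ∷ # 21 ∷ # 29 ∷ # 67 ∷ # 44 ∷ # 63 ∷ # 45 ∷ # 25 ∷
      # 6 ∷ # 51 ∷ # 34 ∷ # 89 ∷ # 54 ∷ # 59 ∷ # 71 ∷ # 20 ∷ # 4 ∷ # 73 ∷ # 49 ∷ # 8 ∷ # 33 ∷
      # 72 ∷ # 17 ∷ # 39 ∷ # 22 ∷ # 43 ∷ # 13 ∷ # 27 ∷ # 10 ∷ # 23 ∷ # 60 ∷ # 66 ∷ # 30 ∷ # 52 ∷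
      [] )
  ∷ ( # 0 ∷ # 24 ∷ # 3 ∷ # 79 ∷ # 72 ∷ # 49 ∷ # 18 ∷ # 42 ∷ # 48 ∷ # 35 ∷ # 36 ∷ # 75 ∷ # 66 ∷
      # 87 ∷ # 13 ∷ # 70 ∷ # 77 ∷ # 84 ∷ # 51 ∷ # 90 ∷ # 45 ∷ # 57 ∷ # 6 ∷ # 9 ∷ # 62 ∷ # 59 ∷
      # 39 ∷ # 28 ∷ # 15 ∷ # 11 ∷ # 8 ∷ # 38 ∷ # 76 ∷ # 89 ∷ # 22 ∷ # 50 ∷ # 73 ∷ # 56 ∷ # 37 ∷
      # 53 ∷ # 47 ∷ # 68 ∷ # 63 ∷ # 29 ∷ # 83 ∷ # 60 ∷ # 71 ∷ # 85 ∷ # 1 ∷ # 23 ∷ # 16 ∷ # 32 ∷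
      # 44 ∷ # 78 ∷ # 82 ∷ # 88 ∷ # 86 ∷ # 81 ∷ # 21 ∷ # 10 ∷ # 40 ∷ # 80 ∷ # 55 ∷ # 46 ∷ # 4 ∷
      # 7 ∷ # 69 ∷ # 41 ∷ # 33 ∷ # 64 ∷ # 67 ∷ # 43 ∷ # 12 ∷ # 17 ∷ # 2 ∷ # 5 ∷ # 25 ∷ # 30 ∷
      # 65 ∷ # 54 ∷ # 19 ∷ # 26 ∷ # 20 ∷ # 34 ∷ # 14 ∷ # 31 ∷ # 61 ∷ # 58 ∷ # 74 ∷ # 52 ∷ # 27 ∷
      [] )
  ∷ ( # 0 ∷ # 25 ∷ # 16 ∷ # 59 ∷ # 34 ∷ # 4 ∷ # 68 ∷ # 80 ∷ # 64 ∷ # 15 ∷ # 48 ∷ # 2 ∷ # 88 ∷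
      # 53 ∷ # 84 ∷ # 19 ∷ # 76 ∷ # 10 ∷ # 71 ∷ # 27 ∷ # 14 ∷ # 39 ∷ # 18 ∷ # 57 ∷ # 73 ∷ # 79 ∷
      # 46 ∷ # 30 ∷ # 75 ∷ # 21 ∷ # 1 ∷ # 35 ∷ # 8 ∷ # 58 ∷ # 41 ∷ # 86 ∷ # 72 ∷ # 31 ∷ # 83 ∷
      # 9 ∷ # 11 ∷ # 52 ∷ # 40 ∷ # 20 ∷ # 66 ∷ # 78 ∷ # 24 ∷ # 32 ∷ # 89 ∷ # 63 ∷ # 61 ∷ # 51 ∷
      # 67 ∷ # 69 ∷ # 77 ∷ # 49 ∷ # 47 ∷ # 3 ∷ # 5 ∷ # 82 ∷ # 17 ∷ # 26 ∷ # 81 ∷ # 55 ∷ # 65 ∷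
      # 13 ∷ # 45 ∷ # 56 ∷ # 43 ∷ # 70 ∷ # 54 ∷ # 50 ∷ # 60 ∷ # 62 ∷ # 36 ∷ # 28 ∷ # 6 ∷ # 33 ∷
      # 38 ∷ # 7 ∷ # 23 ∷ # 42 ∷ # 44 ∷ # 12 ∷ # 90 ∷ # 87 ∷ # 74 ∷ # 37 ∷ # 29 ∷ # 22 ∷ # 85 ∷ [] )
  ∷ ( # 0 ∷ # 10 ∷ # 67 ∷ # 20 ∷ # 58 ∷ # 27 ∷ # 11 ∷ # 24 ∷ # 65 ∷ # 33 ∷ # 54 ∷ # 77 ∷ # 53 ∷
      # 66 ∷ # 45 ∷ # 76 ∷ # 44 ∷ # 62 ∷ # 75 ∷ # 61 ∷ # 46 ∷ # 34 ∷ # 1 ∷ # 42 ∷ # 78 ∷ # 85 ∷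
      # 82 ∷ # 57 ∷ # 64 ∷ # 43 ∷ # 59 ∷ # 81 ∷ # 72 ∷ # 90 ∷ # 49 ∷ # 87 ∷ # 60 ∷ # 73 ∷ # 83 ∷
      # 56 ∷ # 69 ∷ # 86 ∷ # 39 ∷ # 48 ∷ # 30 ∷ # 26 ∷ # 35 ∷ # 15 ∷ # 31 ∷ # 2 ∷ # 16 ∷ # 29 ∷
      # 4 ∷ # 38 ∷ # 18 ∷ # 6 ∷ # 22 ∷ # 7 ∷ # 25 ∷ # 36 ∷ # 74 ∷ # 8 ∷ # 19 ∷ # 13 ∷ # 47 ∷
      # 37 ∷ # 17 ∷ # 9 ∷ # 71 ∷ # 80 ∷ # 51 ∷ # 68 ∷ # 79 ∷ # 63 ∷ # 70 ∷ # 50 ∷ # 28 ∷ # 5 ∷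
      # 32 ∷ # 84 ∷ # 89 ∷ # 14 ∷ # 12 ∷ # 52 ∷ # 41 ∷ # 23 ∷ # 3 ∷ # 88 ∷ # 40 ∷ # 55 ∷ # 21 ∷ [] )
  ∷ ( # 0 ∷ # 70 ∷ # 61 ∷ # 19 ∷ # 2 ∷ # 42 ∷ # 24 ∷ # 48 ∷ # 90 ∷ # 9 ∷ # 87 ∷ # 65 ∷ # 31 ∷
      # 80 ∷ # 3 ∷ # 74 ∷ # 62 ∷ # 7 ∷ # 37 ∷ # 41 ∷ # 82 ∷ # 86 ∷ # 11 ∷ # 32 ∷ # 18 ∷ # 58 ∷
      # 88 ∷ # 68 ∷ # 78 ∷ # 15 ∷ # 50 ∷ # 64 ∷ # 5 ∷ # 47 ∷ # 85 ∷ # 16 ∷ # 12 ∷ # 35 ∷ # 14 ∷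
      # 57 ∷ # 46 ∷ # 84 ∷ # 81 ∷ # 28 ∷ # 56 ∷ # 76 ∷ # 53 ∷ # 26 ∷ # 36 ∷ # 79 ∷ # 38 ∷ # 77 ∷
      # 55 ∷ # 83 ∷ # 40 ∷ # 75 ∷ # 1 ∷ # 69 ∷ # 21 ∷ # 29 ∷ # 67 ∷ # 44 ∷ # 63 ∷ # 45 ∷ # 25 ∷
      # 6 ∷ # 51 ∷ # 34 ∷ # 89 ∷ # 54 ∷ # 59 ∷ # 71 ∷ # 20 ∷ # 4 ∷ # 73 ∷ # 49 ∷ # 8 ∷ # 33 ∷
      # 72 ∷ # 17 ∷ # 39 ∷ # 22 ∷ # 43 ∷ # 13 ∷ # 27 ∷ # 10 ∷ # 23 ∷ # 60 ∷ # 66 ∷ # 30 ∷ # 52 ∷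
      [] )
  ∷ ( # 0 ∷ # 37 ∷ # 44 ∷ # 58 ∷ # 35 ∷ # 33 ∷ # 31 ∷ # 29 ∷ # 46 ∷ # 3 ∷ # 43 ∷ # 84 ∷ # 49 ∷
      # 11 ∷ # 77 ∷ # 89 ∷ # 48 ∷ # 71 ∷ # 7 ∷ # 68 ∷ # 23 ∷ # 47 ∷ # 38 ∷ # 27 ∷ # 90 ∷ # 67 ∷
      # 83 ∷ # 66 ∷ # 70 ∷ # 15 ∷ # 51 ∷ # 52 ∷ # 36 ∷ # 85 ∷ # 2 ∷ # 50 ∷ # 18 ∷ # 26 ∷ # 42 ∷
      # 32 ∷ # 34 ∷ # 86 ∷ # 55 ∷ # 75 ∷ # 54 ∷ # 28 ∷ # 82 ∷ # 81 ∷ # 10 ∷ # 53 ∷ # 16 ∷ # 76 ∷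
      # 74 ∷ # 73 ∷ # 17 ∷ # 25 ∷ # 87 ∷ # 62 ∷ # 8 ∷ # 65 ∷ # 72 ∷ # 6 ∷ # 12 ∷ # 39 ∷ # 41 ∷
      # 19 ∷ # 80 ∷ # 78 ∷ # 14 ∷ # 63 ∷ # 1 ∷ # 5 ∷ # 88 ∷ # 56 ∷ # 24 ∷ # 57 ∷ # 30 ∷ # 45 ∷
      # 4 ∷ # 13 ∷ # 9 ∷ # 59 ∷ # 69 ∷ # 20 ∷ # 64 ∷ # 61 ∷ # 21 ∷ # 22 ∷ # 79 ∷ # 60 ∷ # 40 ∷ [] )
  ∷ ( # 0 ∷ # 30 ∷ # 34 ∷ # 38 ∷ # 59 ∷ # 60 ∷ # 44 ∷ # 43 ∷ # 83 ∷ # 18 ∷ # 16 ∷ # 39 ∷ # 68 ∷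
      # 69 ∷ # 80 ∷ # 73 ∷ # 86 ∷ # 14 ∷ # 25 ∷ # 23 ∷ # 70 ∷ # 7 ∷ # 85 ∷ # 24 ∷ # 22 ∷ # 78 ∷
      # 55 ∷ # 56 ∷ # 87 ∷ # 17 ∷ # 15 ∷ # 26 ∷ # 90 ∷ # 13 ∷ # 1 ∷ # 53 ∷ # 35 ∷ # 64 ∷ # 8 ∷
      # 9 ∷ # 79 ∷ # 37 ∷ # 33 ∷ # 29 ∷ # 52 ∷ # 57 ∷ # 72 ∷ # 71 ∷ # 31 ∷ # 27 ∷ # 36 ∷ # 89 ∷
      # 62 ∷ # 61 ∷ # 82 ∷ # 4 ∷ # 5 ∷ # 6 ∷ # 74 ∷ # 28 ∷ # 65 ∷ # 20 ∷ # 88 ∷ # 77 ∷ # 48 ∷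
      # 49 ∷ # 50 ∷ # 81 ∷ # 54 ∷ # 42 ∷ # 41 ∷ # 40 ∷ # 3 ∷ # 2 ∷ # 47 ∷ # 32 ∷ # 58 ∷ # 63 ∷
      # 76 ∷ # 75 ∷ # 10 ∷ # 11 ∷ # 12 ∷ # 45 ∷ # 19 ∷ # 21 ∷ # 84 ∷ # 67 ∷ # 66 ∷ # 51 ∷ # 46 ∷
      [] )
  ∷ ( # 0 ∷ # 44 ∷ # 79 ∷ # 78 ∷ # 75 ∷ # 74 ∷ # 71 ∷ # 70 ∷ # 65 ∷ # 82 ∷ # 54 ∷ # 32 ∷ # 57 ∷
      # 85 ∷ # 86 ∷ # 87 ∷ # 88 ∷ # 72 ∷ # 7 ∷ # 2 ∷ # 10 ∷ # 5 ∷ # 77 ∷ # 25 ∷ # 22 ∷ # 19 ∷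
      # 16 ∷ # 63 ∷ # 13 ∷ # 68 ∷ # 24 ∷ # 14 ∷ # 76 ∷ # 6 ∷ # 73 ∷ # 30 ∷ # 56 ∷ # 58 ∷ # 39 ∷
      # 45 ∷ # 80 ∷ # 20 ∷ # 17 ∷ # 51 ∷ # 29 ∷ # 36 ∷ # 81 ∷ # 18 ∷ # 21 ∷ # 49 ∷ # 40 ∷ # 64 ∷
      # 59 ∷ # 67 ∷ # 26 ∷ # 23 ∷ # 48 ∷ # 11 ∷ # 42 ∷ # 15 ∷ # 66 ∷ # 8 ∷ # 3 ∷ # 50 ∷ # 52 ∷
      # 53 ∷ # 61 ∷ # 37 ∷ # 31 ∷ # 38 ∷ # 69 ∷ # 89 ∷ # 90 ∷ # 83 ∷ # 84 ∷ # 60 ∷ # 35 ∷ # 28 ∷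
      # 34 ∷ # 27 ∷ # 33 ∷ # 62 ∷ # 1 ∷ # 9 ∷ # 55 ∷ # 47 ∷ # 46 ∷ # 43 ∷ # 4 ∷ # 12 ∷ # 41 ∷ [] )
  ∷ ( # 0 ∷ # 90 ∷ # 23 ∷ # 49 ∷ # 41 ∷ # 30 ∷ # 84 ∷ # 11 ∷ # 87 ∷ # 20 ∷ # 81 ∷ # 76 ∷ # 35 ∷
      # 44 ∷ # 80 ∷ # 18 ∷ # 63 ∷ # 12 ∷ # 82 ∷ # 27 ∷ # 68 ∷ # 42 ∷ # 10 ∷ # 60 ∷ # 67 ∷ # 15 ∷
      # 79 ∷ # 1 ∷ # 74 ∷ # 26 ∷ # 89 ∷ # 64 ∷ # 14 ∷ # 77 ∷ # 29 ∷ # 53 ∷ # 6 ∷ # 46 ∷ # 22 ∷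
      # 75 ∷ # 28 ∷ # 43 ∷ # 24 ∷ # 86 ∷ # 65 ∷ # 4 ∷ # 58 ∷ # 38 ∷ # 51 ∷ # 19 ∷ # 72 ∷ # 32 ∷
      # 59 ∷ # 17 ∷ # 50 ∷ # 31 ∷ # 70 ∷ # 2 ∷ # 62 ∷ # 69 ∷ # 34 ∷ # 56 ∷ # 3 ∷ # 71 ∷ # 88 ∷
      # 36 ∷ # 54 ∷ # 61 ∷ # 7 ∷ # 45 ∷ # 16 ∷ # 55 ∷ # 8 ∷ # 40 ∷ # 25 ∷ # 57 ∷ # 13 ∷ # 83 ∷
      # 21 ∷ # 48 ∷ # 33 ∷ # 39 ∷ # 9 ∷ # 66 ∷ # 73 ∷ # 5 ∷ # 52 ∷ # 85 ∷ # 37 ∷ # 78 ∷ # 47 ∷ [] )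
  ∷ []

edge-orientation : Vec (Vec Bool 91) 10
edge-orientation =
  ( true ∷ true ∷ true ∷ true ∷ true ∷ true ∷ true ∷ true ∷ true ∷ true ∷ true ∷ true ∷ true ∷
      true ∷ true ∷ true ∷ true ∷ true ∷ true ∷ true ∷ true ∷ true ∷ true ∷ true ∷ true ∷ true ∷
      true ∷ true ∷ true ∷ true ∷ true ∷ true ∷ true ∷ true ∷ true ∷ true ∷ true ∷ true ∷ true ∷
      true ∷ true ∷ true ∷ true ∷ true ∷ true ∷ true ∷ true ∷ true ∷ true ∷ true ∷ true ∷ true ∷
      true ∷ true ∷ true ∷ true ∷ true ∷ true ∷ true ∷ true ∷ true ∷ true ∷ true ∷ true ∷ true ∷
      true ∷ true ∷ true ∷ true ∷ true ∷ true ∷ true ∷ true ∷ true ∷ true ∷ true ∷ true ∷ true ∷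
      true ∷ true ∷ true ∷ true ∷ true ∷ true ∷ true ∷ true ∷ true ∷ true ∷ true ∷ true ∷ true ∷
      [] )
  ∷ ( false ∷ false ∷ false ∷ false ∷ true ∷ false ∷ true ∷ true ∷ true ∷ false ∷ true ∷ true ∷
      true ∷ false ∷ false ∷ false ∷ false ∷ false ∷ true ∷ true ∷ true ∷ true ∷ false ∷ false ∷
      true ∷ false ∷ false ∷ true ∷ true ∷ false ∷ true ∷ true ∷ false ∷ true ∷ true ∷ true ∷
      false ∷ false ∷ false ∷ true ∷ false ∷ false ∷ true ∷ true ∷ true ∷ true ∷ true ∷ true ∷
      false ∷ false ∷ false ∷ false ∷ true ∷ false ∷ false ∷ true ∷ true ∷ false ∷ false ∷ true ∷
      true ∷ false ∷ true ∷ true ∷ false ∷ true ∷ true ∷ false ∷ false ∷ true ∷ false ∷ true ∷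
      false ∷ false ∷ false ∷ true ∷ true ∷ true ∷ true ∷ false ∷ false ∷ false ∷ false ∷ true ∷
      false ∷ true ∷ true ∷ true ∷ false ∷ false ∷ true ∷ [] )
  ∷ ( true ∷ true ∷ true ∷ true ∷ true ∷ true ∷ true ∷ true ∷ true ∷ true ∷ true ∷ true ∷ true ∷
      true ∷ true ∷ true ∷ true ∷ true ∷ true ∷ true ∷ true ∷ true ∷ true ∷ true ∷ true ∷ true ∷
      true ∷ true ∷ true ∷ true ∷ true ∷ true ∷ true ∷ true ∷ true ∷ true ∷ true ∷ true ∷ true ∷
      true ∷ true ∷ true ∷ true ∷ true ∷ true ∷ true ∷ true ∷ true ∷ true ∷ true ∷ true ∷ true ∷
      true ∷ true ∷ true ∷ true ∷ true ∷ true ∷ true ∷ true ∷ true ∷ true ∷ true ∷ true ∷ true ∷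
      true ∷ true ∷ true ∷ true ∷ true ∷ true ∷ true ∷ true ∷ true ∷ true ∷ true ∷ true ∷ true ∷
      true ∷ true ∷ true ∷ true ∷ true ∷ true ∷ true ∷ true ∷ true ∷ true ∷ true ∷ true ∷ true ∷
      [] )
  ∷ ( true ∷ true ∷ true ∷ true ∷ true ∷ true ∷ true ∷ true ∷ true ∷ true ∷ true ∷ true ∷ true ∷
      true ∷ true ∷ true ∷ true ∷ true ∷ true ∷ true ∷ true ∷ true ∷ true ∷ true ∷ true ∷ true ∷
      true ∷ true ∷ true ∷ true ∷ true ∷ true ∷ true ∷ true ∷ true ∷ true ∷ true ∷ true ∷ true ∷
      true ∷ true ∷ true ∷ true ∷ true ∷ true ∷ true ∷ true ∷ true ∷ true ∷ true ∷ true ∷ true ∷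
      true ∷ true ∷ true ∷ true ∷ true ∷ true ∷ true ∷ true ∷ true ∷ true ∷ true ∷ true ∷ true ∷
      true ∷ true ∷ true ∷ true ∷ true ∷ true ∷ true ∷ true ∷ true ∷ true ∷ true ∷ true ∷ true ∷
      true ∷ true ∷ true ∷ true ∷ true ∷ true ∷ true ∷ true ∷ true ∷ true ∷ true ∷ true ∷ true ∷
      [] )
  ∷ ( true ∷ true ∷ true ∷ true ∷ true ∷ true ∷ true ∷ true ∷ true ∷ true ∷ true ∷ true ∷ true ∷
      true ∷ true ∷ true ∷ true ∷ true ∷ true ∷ true ∷ true ∷ true ∷ true ∷ true ∷ true ∷ true ∷
      true ∷ true ∷ true ∷ true ∷ true ∷ true ∷ true ∷ true ∷ true ∷ true ∷ true ∷ true ∷ true ∷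
      true ∷ true ∷ true ∷ true ∷ true ∷ true ∷ true ∷ true ∷ true ∷ true ∷ true ∷ true ∷ true ∷
      true ∷ true ∷ true ∷ true ∷ true ∷ true ∷ true ∷ true ∷ true ∷ true ∷ true ∷ true ∷ true ∷
      true ∷ true ∷ true ∷ true ∷ true ∷ true ∷ true ∷ true ∷ true ∷ true ∷ true ∷ true ∷ true ∷
      true ∷ true ∷ true ∷ true ∷ true ∷ true ∷ true ∷ true ∷ true ∷ true ∷ true ∷ true ∷ true ∷
      [] )
  ∷ ( true ∷ true ∷ true ∷ true ∷ false ∷ true ∷ false ∷ false ∷ false ∷ true ∷ false ∷ false ∷
      false ∷ true ∷ true ∷ true ∷ true ∷ true ∷ false ∷ false ∷ false ∷ false ∷ true ∷ true ∷
      false ∷ true ∷ true ∷ false ∷ false ∷ true ∷ false ∷ false ∷ true ∷ false ∷ false ∷ false ∷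
      true ∷ true ∷ true ∷ false ∷ true ∷ true ∷ false ∷ false ∷ false ∷ false ∷ false ∷ false ∷
      true ∷ true ∷ true ∷ true ∷ false ∷ true ∷ true ∷ false ∷ false ∷ true ∷ true ∷ false ∷
      false ∷ true ∷ false ∷ false ∷ true ∷ false ∷ false ∷ true ∷ true ∷ false ∷ true ∷ false ∷
      true ∷ true ∷ true ∷ false ∷ false ∷ false ∷ false ∷ true ∷ true ∷ true ∷ true ∷ false ∷
      true ∷ false ∷ false ∷ false ∷ true ∷ true ∷ false ∷ [] )
  ∷ ( true ∷ true ∷ true ∷ true ∷ true ∷ true ∷ true ∷ true ∷ true ∷ true ∷ true ∷ true ∷ true ∷
      true ∷ true ∷ true ∷ true ∷ true ∷ true ∷ true ∷ true ∷ true ∷ true ∷ true ∷ true ∷ true ∷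
      true ∷ true ∷ true ∷ true ∷ true ∷ true ∷ true ∷ true ∷ true ∷ true ∷ true ∷ true ∷ true ∷
      true ∷ true ∷ true ∷ true ∷ true ∷ true ∷ true ∷ true ∷ true ∷ true ∷ true ∷ true ∷ true ∷
      true ∷ true ∷ true ∷ true ∷ true ∷ true ∷ true ∷ true ∷ true ∷ true ∷ true ∷ true ∷ true ∷
      true ∷ true ∷ true ∷ true ∷ true ∷ true ∷ true ∷ true ∷ true ∷ true ∷ true ∷ true ∷ true ∷
      true ∷ true ∷ true ∷ true ∷ true ∷ true ∷ true ∷ true ∷ true ∷ true ∷ true ∷ true ∷ true ∷
      [] )
  ∷ ( true ∷ true ∷ true ∷ true ∷ true ∷ true ∷ true ∷ true ∷ true ∷ true ∷ true ∷ true ∷ true ∷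
      true ∷ true ∷ true ∷ true ∷ true ∷ true ∷ true ∷ true ∷ true ∷ true ∷ true ∷ true ∷ true ∷
      true ∷ true ∷ true ∷ true ∷ true ∷ true ∷ true ∷ true ∷ true ∷ true ∷ true ∷ true ∷ true ∷
      true ∷ true ∷ true ∷ true ∷ true ∷ true ∷ true ∷ true ∷ true ∷ true ∷ true ∷ true ∷ true ∷
      true ∷ true ∷ true ∷ true ∷ true ∷ true ∷ true ∷ true ∷ true ∷ true ∷ true ∷ true ∷ true ∷
      true ∷ true ∷ true ∷ true ∷ true ∷ true ∷ true ∷ true ∷ true ∷ true ∷ true ∷ true ∷ true ∷
      true ∷ true ∷ true ∷ true ∷ true ∷ true ∷ true ∷ true ∷ true ∷ true ∷ true ∷ true ∷ true ∷
      [] )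
  ∷ ( true ∷ true ∷ true ∷ true ∷ true ∷ true ∷ true ∷ true ∷ true ∷ true ∷ true ∷ true ∷ true ∷
      true ∷ true ∷ true ∷ true ∷ true ∷ true ∷ true ∷ true ∷ true ∷ true ∷ true ∷ true ∷ true ∷
      true ∷ true ∷ true ∷ true ∷ true ∷ true ∷ true ∷ true ∷ true ∷ true ∷ true ∷ true ∷ true ∷
      true ∷ true ∷ true ∷ true ∷ true ∷ true ∷ true ∷ true ∷ true ∷ true ∷ true ∷ true ∷ true ∷
      true ∷ true ∷ true ∷ true ∷ true ∷ true ∷ true ∷ true ∷ true ∷ true ∷ true ∷ true ∷ true ∷
      true ∷ true ∷ true ∷ true ∷ true ∷ true ∷ true ∷ true ∷ true ∷ true ∷ true ∷ true ∷ true ∷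
      true ∷ true ∷ true ∷ true ∷ true ∷ true ∷ true ∷ true ∷ true ∷ true ∷ true ∷ true ∷ true ∷
      [] )
  ∷ ( true ∷ true ∷ true ∷ true ∷ true ∷ true ∷ true ∷ true ∷ true ∷ true ∷ true ∷ true ∷ true ∷
      true ∷ true ∷ true ∷ true ∷ true ∷ true ∷ true ∷ true ∷ true ∷ true ∷ true ∷ true ∷ true ∷
      true ∷ true ∷ true ∷ true ∷ true ∷ true ∷ true ∷ true ∷ true ∷ true ∷ true ∷ true ∷ true ∷
      true ∷ true ∷ true ∷ true ∷ true ∷ true ∷ true ∷ true ∷ true ∷ true ∷ true ∷ true ∷ true ∷
      true ∷ true ∷ true ∷ true ∷ true ∷ true ∷ true ∷ true ∷ true ∷ true ∷ true ∷ true ∷ true ∷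
      true ∷ true ∷ true ∷ true ∷ true ∷ true ∷ true ∷ true ∷ true ∷ true ∷ true ∷ true ∷ true ∷
      true ∷ true ∷ true ∷ true ∷ true ∷ true ∷ true ∷ true ∷ true ∷ true ∷ true ∷ true ∷ true ∷
      [] )
  ∷ []

edge-witness-table : Vec (Vec NMat 91) 10
edge-witness-table =
  ( nm 2 8 4 10 ∷ nm 1 4 8 7 ∷ nm 1 1 7 8 ∷ nm 9 9 8 11 ∷ nm 11 2 12 7 ∷ nm 5 8 3 5 ∷
      nm 9 6 11 6 ∷ nm 3 11 4 2 ∷ nm 7 12 7 1 ∷ nm 11 4 8 3 ∷ nm 9 0 0 3 ∷ nm 4 4 8 5 ∷
      nm 7 11 4 12 ∷ nm 11 4 3 0 ∷ nm 1 11 7 0 ∷ nm 0 2 6 7 ∷ nm 5 10 3 1 ∷ nm 7 1 4 10 ∷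
      nm 1 6 6 11 ∷ nm 11 3 0 6 ∷ nm 12 8 0 12 ∷ nm 12 10 3 8 ∷ nm 7 8 7 10 ∷ nm 8 2 5 3 ∷
      nm 9 12 3 7 ∷ nm 0 4 3 12 ∷ nm 9 1 8 1 ∷ nm 8 2 1 2 ∷ nm 1 7 7 11 ∷ nm 6 0 8 11 ∷
      nm 8 6 5 12 ∷ nm 9 10 3 2 ∷ nm 0 4 3 7 ∷ nm 4 9 8 2 ∷ nm 7 0 3 2 ∷ nm 10 7 4 12 ∷
      nm 3 7 3 3 ∷ nm 7 0 7 2 ∷ nm 11 0 8 6 ∷ nm 8 5 3 2 ∷ nm 7 6 9 6 ∷ nm 1 8 7 5 ∷ nm 9 7 8 2 ∷
      nm 10 8 8 0 ∷ nm 5 4 3 0 ∷ nm 7 6 3 12 ∷ nm 3 6 4 4 ∷ nm 1 2 12 12 ∷ nm 3 4 3 0 ∷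
      nm 1 9 12 5 ∷ nm 9 3 10 2 ∷ nm 2 12 4 5 ∷ nm 11 6 12 9 ∷ nm 5 11 3 12 ∷ nm 9 1 11 10 ∷
      nm 3 5 4 7 ∷ nm 3 4 10 5 ∷ nm 11 5 8 12 ∷ nm 12 9 3 11 ∷ nm 1 2 9 6 ∷ nm 9 3 8 10 ∷
      nm 10 5 8 8 ∷ nm 12 11 3 5 ∷ nm 6 12 6 10 ∷ nm 9 12 10 12 ∷ nm 11 2 4 2 ∷ nm 11 10 1 1 ∷
      nm 1 0 3 1 ∷ nm 8 11 5 7 ∷ nm 9 1 3 12 ∷ nm 12 3 0 12 ∷ nm 5 0 3 8 ∷ nm 6 0 9 11 ∷
      nm 1 4 6 12 ∷ nm 7 12 8 12 ∷ nm 3 7 10 2 ∷ nm 9 0 10 3 ∷ nm 0 4 3 5 ∷ nm 9 6 8 4 ∷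
      nm 6 8 4 12 ∷ nm 3 11 2 12 ∷ nm 1 8 6 10 ∷ nm 11 12 0 6 ∷ nm 10 0 4 4 ∷ nm 7 5 6 10 ∷
      nm 10 9 12 7 ∷ nm 8 1 3 7 ∷ nm 1 2 6 0 ∷ nm 0 2 6 6 ∷ nm 1 3 3 10 ∷ nm 9 11 10 8 ∷ [] )
  ∷ ( nm 9 1 3 12 ∷ nm 7 0 10 2 ∷ nm 7 12 8 12 ∷ nm 9 4 0 3 ∷ nm 1 2 2 5 ∷ nm 6 3 1 5 ∷
      nm 9 8 1 1 ∷ nm 7 8 4 1 ∷ nm 7 7 7 9 ∷ nm 11 5 8 12 ∷ nm 9 4 10 6 ∷ nm 12 8 12 7 ∷
      nm 2 7 4 8 ∷ nm 12 5 2 2 ∷ nm 10 3 12 5 ∷ nm 8 10 12 7 ∷ nm 1 9 3 2 ∷ nm 12 5 0 12 ∷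
      nm 10 10 4 8 ∷ nm 5 0 1 8 ∷ nm 2 2 8 2 ∷ nm 7 6 7 8 ∷ nm 5 10 0 8 ∷ nm 10 11 0 4 ∷
      nm 0 2 6 4 ∷ nm 8 10 6 6 ∷ nm 2 12 3 12 ∷ nm 8 5 12 6 ∷ nm 1 7 9 12 ∷ nm 5 5 4 12 ∷
      nm 8 7 12 9 ∷ nm 10 9 12 7 ∷ nm 11 10 8 5 ∷ nm 1 1 4 5 ∷ nm 3 5 3 1 ∷ nm 6 6 8 6 ∷
      nm 12 10 0 12 ∷ nm 11 0 0 6 ∷ nm 1 10 6 9 ∷ nm 2 12 1 0 ∷ nm 8 7 6 7 ∷ nm 7 2 10 3 ∷
      nm 9 10 2 11 ∷ nm 10 6 4 9 ∷ nm 3 12 2 4 ∷ nm 1 11 7 0 ∷ nm 3 10 3 6 ∷ nm 10 7 0 4 ∷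
      nm 7 11 11 10 ∷ nm 0 4 3 12 ∷ nm 9 1 2 9 ∷ nm 11 0 3 6 ∷ nm 10 0 2 4 ∷ nm 1 0 4 1 ∷
      nm 9 7 10 5 ∷ nm 9 10 9 0 ∷ nm 5 2 3 4 ∷ nm 7 10 8 6 ∷ nm 3 11 4 2 ∷ nm 11 10 7 10 ∷
      nm 11 9 3 12 ∷ nm 5 2 12 5 ∷ nm 6 9 3 9 ∷ nm 1 0 9 1 ∷ nm 7 4 0 2 ∷ nm 1 11 2 10 ∷
      nm 9 2 2 2 ∷ nm 11 10 2 9 ∷ nm 1 7 7 11 ∷ nm 10 6 5 7 ∷ nm 10 3 1 3 ∷ nm 5 12 6 12 ∷
      nm 9 12 0 3 ∷ nm 10 10 8 12 ∷ nm 11 2 3 3 ∷ nm 10 9 8 6 ∷ nm 8 12 2 8 ∷ nm 3 6 7 10 ∷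
      nm 8 2 9 4 ∷ nm 7 5 6 10 ∷ nm 0 10 9 12 ∷ nm 5 0 4 8 ∷ nm 8 10 3 12 ∷ nm 12 1 3 9 ∷
      nm 8 9 2 4 ∷ nm 9 10 0 3 ∷ nm 9 0 1 3 ∷ nm 4 7 7 6 ∷ nm 3 3 7 3 ∷ nm 9 0 3 3 ∷ nm 5 5 5 0 ∷
      [] )
  ∷ ( nm 2 12 7 10 ∷ nm 6 1 8 8 ∷ nm 12 5 2 2 ∷ nm 10 10 1 5 ∷ nm 3 10 2 7 ∷ nm 9 10 7 5 ∷
      nm 9 12 1 0 ∷ nm 6 5 4 10 ∷ nm 10 9 5 2 ∷ nm 0 7 11 7 ∷ nm 3 9 7 4 ∷ nm 10 0 1 4 ∷
      nm 7 6 3 12 ∷ nm 8 10 5 8 ∷ nm 5 7 3 7 ∷ nm 7 8 2 8 ∷ nm 10 7 8 7 ∷ nm 8 7 6 7 ∷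
      nm 10 11 8 5 ∷ nm 1 12 9 5 ∷ nm 11 1 5 10 ∷ nm 8 2 4 6 ∷ nm 0 1 12 5 ∷ nm 5 2 2 1 ∷
      nm 5 2 4 7 ∷ nm 9 9 9 12 ∷ nm 11 8 2 11 ∷ nm 2 9 7 6 ∷ nm 6 5 8 9 ∷ nm 0 5 5 2 ∷
      nm 12 9 3 11 ∷ nm 10 0 7 4 ∷ nm 8 10 9 0 ∷ nm 6 2 7 9 ∷ nm 4 5 8 7 ∷ nm 3 9 2 2 ∷
      nm 8 2 1 2 ∷ nm 2 8 3 6 ∷ nm 3 10 7 2 ∷ nm 5 10 6 7 ∷ nm 10 2 1 12 ∷ nm 9 9 6 9 ∷
      nm 2 1 1 1 ∷ nm 3 2 7 5 ∷ nm 1 8 4 7 ∷ nm 2 11 12 8 ∷ nm 7 10 11 1 ∷ nm 8 2 5 3 ∷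
      nm 9 0 0 3 ∷ nm 0 2 6 9 ∷ nm 11 8 0 6 ∷ nm 2 12 4 5 ∷ nm 9 6 2 0 ∷ nm 1 7 9 12 ∷
      nm 10 10 12 3 ∷ nm 5 11 5 6 ∷ nm 2 6 8 5 ∷ nm 7 2 10 3 ∷ nm 6 11 8 4 ∷ nm 12 12 2 1 ∷
      nm 9 5 10 10 ∷ nm 1 7 5 10 ∷ nm 9 4 2 1 ∷ nm 1 0 12 1 ∷ nm 0 1 12 3 ∷ nm 8 6 3 4 ∷
      nm 7 1 9 7 ∷ nm 11 12 10 11 ∷ nm 11 12 4 8 ∷ nm 8 6 6 3 ∷ nm 11 9 3 12 ∷ nm 1 0 7 1 ∷
      nm 7 1 0 2 ∷ nm 6 7 8 3 ∷ nm 0 1 12 1 ∷ nm 9 3 0 3 ∷ nm 11 5 0 6 ∷ nm 3 3 7 3 ∷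
      nm 10 6 1 2 ∷ nm 7 2 4 5 ∷ nm 0 10 9 1 ∷ nm 0 10 9 5 ∷ nm 11 11 0 6 ∷ nm 2 0 7 7 ∷
      nm 11 0 0 6 ∷ nm 10 3 4 0 ∷ nm 1 3 6 6 ∷ nm 10 12 12 8 ∷ nm 9 10 3 2 ∷ nm 3 2 10 7 ∷
      nm 0 4 3 1 ∷ [] )
  ∷ ( nm 3 12 7 11 ∷ nm 0 2 6 11 ∷ nm 6 6 8 6 ∷ nm 3 0 3 9 ∷ nm 5 9 0 8 ∷ nm 1 12 3 11 ∷
      nm 12 1 8 4 ∷ nm 4 8 2 1 ∷ nm 7 3 7 5 ∷ nm 9 1 1 6 ∷ nm 5 5 1 9 ∷ nm 12 3 3 3 ∷
      nm 4 0 9 10 ∷ nm 11 2 2 4 ∷ nm 7 12 7 1 ∷ nm 9 7 1 11 ∷ nm 5 4 1 1 ∷ nm 8 9 2 4 ∷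
      nm 3 6 3 2 ∷ nm 3 0 7 9 ∷ nm 4 4 8 5 ∷ nm 4 1 4 11 ∷ nm 7 0 8 2 ∷ nm 1 10 6 9 ∷
      nm 11 11 12 5 ∷ nm 11 5 2 1 ∷ nm 11 5 11 11 ∷ nm 2 6 7 2 ∷ nm 9 10 9 0 ∷ nm 6 0 1 11 ∷
      nm 5 2 3 4 ∷ nm 5 2 0 8 ∷ nm 8 11 3 1 ∷ nm 2 5 8 1 ∷ nm 4 6 2 0 ∷ nm 8 2 6 0 ∷
      nm 11 2 10 9 ∷ nm 10 7 7 5 ∷ nm 5 1 6 4 ∷ nm 0 1 12 8 ∷ nm 12 12 3 2 ∷ nm 1 1 12 0 ∷
      nm 7 1 11 11 ∷ nm 9 2 1 9 ∷ nm 10 0 5 4 ∷ nm 9 6 3 5 ∷ nm 11 1 0 6 ∷ nm 2 3 7 11 ∷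
      nm 1 11 4 6 ∷ nm 5 2 12 5 ∷ nm 6 10 4 9 ∷ nm 1 9 6 3 ∷ nm 1 4 6 12 ∷ nm 9 3 2 8 ∷
      nm 1 6 6 11 ∷ nm 5 5 9 4 ∷ nm 5 5 6 1 ∷ nm 0 1 12 2 ∷ nm 12 6 3 7 ∷ nm 9 2 3 8 ∷
      nm 0 10 9 11 ∷ nm 7 5 8 4 ∷ nm 1 7 6 4 ∷ nm 11 4 12 8 ∷ nm 5 7 6 6 ∷ nm 12 1 3 9 ∷
      nm 11 1 5 10 ∷ nm 3 12 2 4 ∷ nm 9 1 11 10 ∷ nm 2 9 8 4 ∷ nm 4 3 7 12 ∷ nm 9 8 6 4 ∷
      nm 1 3 5 3 ∷ nm 2 10 3 9 ∷ nm 0 7 11 2 ∷ nm 5 12 0 8 ∷ nm 5 3 3 2 ∷ nm 0 7 11 4 ∷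
      nm 5 7 0 8 ∷ nm 7 10 0 2 ∷ nm 7 8 8 0 ∷ nm 1 0 6 1 ∷ nm 1 0 8 1 ∷ nm 8 5 3 2 ∷
      nm 1 11 12 3 ∷ nm 6 9 7 2 ∷ nm 10 3 12 5 ∷ nm 0 7 11 10 ∷ nm 11 6 4 7 ∷ nm 4 5 8 7 ∷
      nm 3 5 3 1 ∷ [] )
  ∷ ( nm 5 0 0 8 ∷ nm 1 6 3 6 ∷ nm 5 7 9 5 ∷ nm 0 2 6 6 ∷ nm 11 1 11 7 ∷ nm 2 4 7 8 ∷
      nm 9 1 0 3 ∷ nm 0 10 9 2 ∷ nm 3 3 3 12 ∷ nm 11 3 7 2 ∷ nm 7 5 3 6 ∷ nm 12 2 5 2 ∷
      nm 1 2 4 9 ∷ nm 5 7 1 12 ∷ nm 10 4 3 0 ∷ nm 2 4 12 5 ∷ nm 1 8 6 10 ∷ nm 12 2 8 9 ∷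
      nm 8 4 5 1 ∷ nm 6 10 4 9 ∷ nm 11 5 11 11 ∷ nm 3 3 4 0 ∷ nm 1 2 3 7 ∷ nm 11 4 3 0 ∷
      nm 9 6 3 5 ∷ nm 11 7 8 4 ∷ nm 2 2 8 2 ∷ nm 11 10 3 4 ∷ nm 4 11 9 12 ∷ nm 12 5 8 11 ∷
      nm 6 6 7 5 ∷ nm 10 4 8 2 ∷ nm 7 10 4 4 ∷ nm 2 10 8 8 ∷ nm 12 7 5 3 ∷ nm 10 1 1 8 ∷
      nm 2 11 12 8 ∷ nm 10 4 2 10 ∷ nm 1 8 4 7 ∷ nm 11 1 1 12 ∷ nm 7 1 9 7 ∷ nm 9 7 3 1 ∷
      nm 1 12 4 10 ∷ nm 4 10 2 2 ∷ nm 11 1 4 4 ∷ nm 10 7 0 4 ∷ nm 3 8 7 6 ∷ nm 6 5 8 9 ∷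
      nm 3 0 4 9 ∷ nm 7 6 0 2 ∷ nm 4 3 1 1 ∷ nm 12 12 0 12 ∷ nm 12 6 2 0 ∷ nm 2 3 4 0 ∷
      nm 7 2 1 6 ∷ nm 12 7 3 4 ∷ nm 4 5 8 7 ∷ nm 7 10 0 2 ∷ nm 6 2 8 5 ∷ nm 0 7 11 2 ∷
      nm 5 12 5 7 ∷ nm 7 3 0 2 ∷ nm 9 5 8 6 ∷ nm 0 1 12 12 ∷ nm 3 7 3 3 ∷ nm 10 1 7 6 ∷
      nm 9 2 8 12 ∷ nm 0 1 12 8 ∷ nm 1 5 4 8 ∷ nm 2 6 12 4 ∷ nm 1 9 6 3 ∷ nm 12 1 8 4 ∷
      nm 6 4 7 7 ∷ nm 11 8 3 7 ∷ nm 4 2 9 8 ∷ nm 9 10 11 8 ∷ nm 5 12 0 8 ∷ nm 5 8 3 5 ∷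
      nm 0 7 11 9 ∷ nm 9 11 3 11 ∷ nm 9 3 9 6 ∷ nm 6 6 1 12 ∷ nm 0 5 5 10 ∷ nm 1 1 12 0 ∷
      nm 1 5 7 10 ∷ nm 7 10 1 9 ∷ nm 0 5 5 3 ∷ nm 9 3 3 4 ∷ nm 11 6 2 0 ∷ nm 5 10 9 0 ∷
      nm 10 3 0 4 ∷ [] )
  ∷ ( nm 2 12 7 10 ∷ nm 1 4 12 10 ∷ nm 10 10 2 6 ∷ nm 4 3 8 3 ∷ nm 8 1 1 10 ∷ nm 5 0 9 8 ∷
      nm 11 10 10 8 ∷ nm 2 10 8 8 ∷ nm 5 1 3 6 ∷ nm 12 10 3 8 ∷ nm 3 3 3 12 ∷ nm 3 4 7 1 ∷
      nm 3 3 2 11 ∷ nm 10 4 5 6 ∷ nm 8 0 2 5 ∷ nm 7 2 2 10 ∷ nm 6 0 9 11 ∷ nm 1 10 2 8 ∷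
      nm 5 0 1 8 ∷ nm 7 3 2 1 ∷ nm 5 6 5 1 ∷ nm 5 4 3 0 ∷ nm 8 0 3 5 ∷ nm 10 6 7 3 ∷ nm 1 3 9 2 ∷
      nm 7 9 7 11 ∷ nm 8 10 6 6 ∷ nm 7 9 2 12 ∷ nm 6 5 8 9 ∷ nm 0 10 9 8 ∷ nm 7 1 2 6 ∷
      nm 8 10 2 1 ∷ nm 12 6 3 7 ∷ nm 9 11 9 1 ∷ nm 9 7 8 2 ∷ nm 9 5 0 3 ∷ nm 1 5 2 11 ∷
      nm 2 1 4 9 ∷ nm 0 2 6 0 ∷ nm 4 12 9 11 ∷ nm 7 8 7 10 ∷ nm 1 8 12 6 ∷ nm 0 7 11 3 ∷
      nm 8 2 12 8 ∷ nm 7 7 3 5 ∷ nm 11 2 2 4 ∷ nm 9 9 8 11 ∷ nm 10 2 7 8 ∷ nm 3 5 4 7 ∷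
      nm 7 11 11 10 ∷ nm 0 7 11 5 ∷ nm 9 1 2 9 ∷ nm 1 8 4 7 ∷ nm 9 2 9 5 ∷ nm 3 4 3 0 ∷
      nm 12 3 2 6 ∷ nm 2 3 1 2 ∷ nm 3 4 11 2 ∷ nm 11 2 0 6 ∷ nm 12 4 5 5 ∷ nm 9 6 2 0 ∷
      nm 10 1 8 10 ∷ nm 12 1 1 11 ∷ nm 6 2 8 5 ∷ nm 7 8 1 5 ∷ nm 5 5 12 7 ∷ nm 0 7 11 12 ∷
      nm 11 11 7 0 ∷ nm 11 10 2 9 ∷ nm 6 6 7 5 ∷ nm 12 9 12 8 ∷ nm 4 10 1 6 ∷ nm 4 8 8 0 ∷
      nm 0 5 5 11 ∷ nm 9 5 2 7 ∷ nm 0 5 5 4 ∷ nm 12 2 0 12 ∷ nm 4 0 2 10 ∷ nm 0 10 9 11 ∷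
      nm 7 1 8 5 ∷ nm 8 5 7 11 ∷ nm 0 10 9 12 ∷ nm 12 5 8 11 ∷ nm 5 6 0 8 ∷ nm 12 4 0 12 ∷
      nm 4 10 8 4 ∷ nm 11 6 10 2 ∷ nm 8 7 9 8 ∷ nm 4 9 2 8 ∷ nm 2 6 7 2 ∷ nm 2 5 9 10 ∷ [] )
  ∷ ( nm 5 0 0 8 ∷ nm 0 7 11 10 ∷ nm 1 0 8 1 ∷ nm 4 7 9 3 ∷ nm 5 2 0 8 ∷ nm 5 3 0 8 ∷
      nm 5 4 0 8 ∷ nm 11 10 7 10 ∷ nm 11 5 11 11 ∷ nm 5 5 3 11 ∷ nm 7 8 3 11 ∷ nm 10 7 12 2 ∷
      nm 7 12 10 8 ∷ nm 0 5 5 2 ∷ nm 10 7 8 7 ∷ nm 11 3 8 7 ∷ nm 11 10 10 8 ∷ nm 11 9 2 10 ∷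
      nm 0 1 12 6 ∷ nm 9 9 6 9 ∷ nm 9 0 1 3 ∷ nm 9 4 9 7 ∷ nm 12 9 0 12 ∷ nm 2 0 4 7 ∷
      nm 10 11 12 12 ∷ nm 9 9 2 5 ∷ nm 7 5 11 8 ∷ nm 7 6 3 12 ∷ nm 1 4 12 10 ∷ nm 9 12 8 5 ∷
      nm 4 9 6 4 ∷ nm 7 2 7 4 ∷ nm 10 2 7 8 ∷ nm 3 5 3 1 ∷ nm 5 10 3 1 ∷ nm 9 8 6 4 ∷
      nm 4 0 1 10 ∷ nm 9 9 8 11 ∷ nm 5 0 9 8 ∷ nm 12 11 0 12 ∷ nm 2 9 4 12 ∷ nm 10 4 12 1 ∷
      nm 9 4 2 1 ∷ nm 7 4 11 12 ∷ nm 1 7 7 11 ∷ nm 2 5 4 4 ∷ nm 9 2 3 8 ∷ nm 8 5 1 4 ∷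
      nm 1 6 3 6 ∷ nm 8 11 5 7 ∷ nm 6 8 1 8 ∷ nm 2 4 12 5 ∷ nm 9 10 3 2 ∷ nm 11 11 12 5 ∷
      nm 4 8 1 12 ∷ nm 9 3 1 12 ∷ nm 5 11 6 3 ∷ nm 12 2 8 9 ∷ nm 1 8 3 12 ∷ nm 5 7 6 6 ∷
      nm 4 0 2 10 ∷ nm 7 4 0 2 ∷ nm 1 5 2 11 ∷ nm 8 5 7 11 ∷ nm 10 12 5 10 ∷ nm 0 10 9 1 ∷
      nm 2 6 12 4 ∷ nm 1 6 12 8 ∷ nm 9 4 8 8 ∷ nm 6 9 3 9 ∷ nm 8 3 2 9 ∷ nm 5 9 2 9 ∷
      nm 7 11 2 7 ∷ nm 9 4 6 10 ∷ nm 0 2 6 10 ∷ nm 11 10 3 4 ∷ nm 2 2 4 11 ∷ nm 2 6 2 0 ∷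
      nm 12 5 3 10 ∷ nm 12 1 3 9 ∷ nm 1 7 3 9 ∷ nm 9 6 10 1 ∷ nm 2 3 1 2 ∷ nm 7 0 1 2 ∷
      nm 9 5 3 9 ∷ nm 6 10 4 9 ∷ nm 11 2 0 6 ∷ nm 4 5 8 7 ∷ nm 7 11 11 10 ∷ nm 5 2 1 11 ∷
      nm 6 1 7 10 ∷ [] )
  ∷ ( nm 1 0 0 1 ∷ nm 12 3 0 12 ∷ nm 12 6 0 12 ∷ nm 0 4 3 12 ∷ nm 3 0 3 9 ∷ nm 3 4 2 3 ∷
      nm 9 6 2 0 ∷ nm 1 0 7 1 ∷ nm 8 7 5 11 ∷ nm 10 11 0 4 ∷ nm 9 7 8 2 ∷ nm 1 0 1 1 ∷
      nm 2 12 3 12 ∷ nm 1 4 8 7 ∷ nm 1 7 5 10 ∷ nm 11 11 12 5 ∷ nm 1 9 12 5 ∷ nm 10 0 0 4 ∷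
      nm 10 1 0 4 ∷ nm 0 2 6 9 ∷ nm 7 8 2 8 ∷ nm 0 1 12 6 ∷ nm 8 2 5 3 ∷ nm 10 8 0 4 ∷
      nm 0 2 6 8 ∷ nm 7 11 7 0 ∷ nm 11 0 3 6 ∷ nm 1 2 7 2 ∷ nm 8 10 5 8 ∷ nm 10 5 0 4 ∷
      nm 10 6 0 4 ∷ nm 0 2 6 12 ∷ nm 7 5 2 9 ∷ nm 9 9 0 3 ∷ nm 0 1 12 0 ∷ nm 1 2 4 9 ∷
      nm 11 2 4 2 ∷ nm 7 1 2 6 ∷ nm 9 2 0 3 ∷ nm 0 1 12 8 ∷ nm 1 7 4 3 ∷ nm 5 1 0 8 ∷
      nm 5 3 0 8 ∷ nm 11 6 4 7 ∷ nm 7 2 7 4 ∷ nm 1 2 8 4 ∷ nm 4 0 2 10 ∷ nm 1 5 4 8 ∷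
      nm 5 4 0 8 ∷ nm 5 6 0 8 ∷ nm 0 4 3 10 ∷ nm 3 11 3 7 ∷ nm 3 2 2 6 ∷ nm 11 2 12 7 ∷
      nm 7 3 2 1 ∷ nm 9 12 0 3 ∷ nm 9 3 0 3 ∷ nm 5 3 3 2 ∷ nm 9 10 3 2 ∷ nm 0 4 3 2 ∷
      nm 8 1 5 4 ∷ nm 0 2 6 6 ∷ nm 7 0 7 2 ∷ nm 11 5 3 5 ∷ nm 7 11 3 3 ∷ nm 11 2 3 3 ∷
      nm 6 1 9 6 ∷ nm 11 3 3 8 ∷ nm 1 2 5 11 ∷ nm 10 6 2 0 ∷ nm 4 6 2 0 ∷ nm 11 6 2 0 ∷
      nm 7 12 0 2 ∷ nm 0 1 12 1 ∷ nm 1 1 4 5 ∷ nm 11 4 4 11 ∷ nm 7 9 7 11 ∷ nm 1 3 8 12 ∷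
      nm 4 4 2 12 ∷ nm 11 7 2 12 ∷ nm 9 10 0 3 ∷ nm 9 1 0 3 ∷ nm 5 12 3 10 ∷ nm 1 0 9 1 ∷
      nm 11 7 0 6 ∷ nm 0 2 6 7 ∷ nm 7 12 7 1 ∷ nm 10 7 2 8 ∷ nm 3 7 2 5 ∷ nm 6 10 3 3 ∷
      nm 9 4 3 0 ∷ [] )
  ∷ ( nm 0 4 3 0 ∷ nm 7 12 9 10 ∷ nm 11 5 2 1 ∷ nm 7 9 2 12 ∷ nm 11 7 2 12 ∷ nm 7 2 2 10 ∷
      nm 11 9 2 10 ∷ nm 7 8 2 8 ∷ nm 1 4 4 4 ∷ nm 9 2 3 8 ∷ nm 7 5 3 6 ∷ nm 0 4 3 6 ∷
      nm 7 0 9 2 ∷ nm 3 5 3 1 ∷ nm 3 0 10 9 ∷ nm 3 8 3 4 ∷ nm 9 3 3 4 ∷ nm 4 0 2 10 ∷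
      nm 9 11 0 3 ∷ nm 9 4 0 3 ∷ nm 9 10 0 3 ∷ nm 0 1 12 4 ∷ nm 1 6 6 11 ∷ nm 10 1 0 4 ∷
      nm 10 9 0 4 ∷ nm 10 4 0 4 ∷ nm 7 2 8 8 ∷ nm 6 9 3 9 ∷ nm 1 3 3 10 ∷ nm 8 5 12 6 ∷
      nm 11 1 0 6 ∷ nm 0 2 6 0 ∷ nm 4 4 2 12 ∷ nm 0 1 12 5 ∷ nm 9 5 2 7 ∷ nm 10 4 4 3 ∷
      nm 3 12 2 4 ∷ nm 1 2 12 12 ∷ nm 4 4 3 0 ∷ nm 1 0 9 1 ∷ nm 10 4 5 6 ∷ nm 10 10 0 4 ∷
      nm 7 1 8 5 ∷ nm 9 2 2 2 ∷ nm 5 5 0 8 ∷ nm 0 4 3 10 ∷ nm 1 7 6 4 ∷ nm 11 3 0 6 ∷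
      nm 7 10 8 6 ∷ nm 11 2 3 3 ∷ nm 1 0 4 1 ∷ nm 7 1 2 6 ∷ nm 11 6 8 8 ∷ nm 1 4 6 12 ∷
      nm 10 7 0 4 ∷ nm 0 2 6 9 ∷ nm 4 10 2 2 ∷ nm 0 1 12 10 ∷ nm 1 0 6 1 ∷ nm 0 2 6 1 ∷
      nm 4 9 2 8 ∷ nm 9 2 0 3 ∷ nm 1 0 3 1 ∷ nm 3 9 2 2 ∷ nm 3 2 10 7 ∷ nm 11 8 8 0 ∷
      nm 9 0 2 3 ∷ nm 5 1 0 8 ∷ nm 5 4 0 8 ∷ nm 0 4 3 12 ∷ nm 7 1 9 7 ∷ nm 3 11 3 7 ∷
      nm 1 11 12 3 ∷ nm 3 2 3 11 ∷ nm 9 11 3 11 ∷ nm 7 12 3 9 ∷ nm 12 10 0 12 ∷ nm 12 8 0 12 ∷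
      nm 12 6 0 12 ∷ nm 12 4 0 12 ∷ nm 10 1 4 7 ∷ nm 2 10 3 9 ∷ nm 9 0 0 3 ∷ nm 0 1 12 8 ∷
      nm 11 0 3 6 ∷ nm 11 4 2 2 ∷ nm 9 4 3 0 ∷ nm 2 4 3 0 ∷ nm 9 12 0 3 ∷ nm 1 4 3 0 ∷
      nm 7 4 3 0 ∷ [] )
  ∷ ( nm 2 12 7 10 ∷ nm 7 5 2 9 ∷ nm 0 2 6 9 ∷ nm 11 2 3 3 ∷ nm 7 4 3 0 ∷ nm 5 11 0 8 ∷
      nm 1 8 12 6 ∷ nm 9 1 0 3 ∷ nm 3 8 3 4 ∷ nm 0 2 6 6 ∷ nm 11 3 3 8 ∷ nm 7 7 3 5 ∷
      nm 10 12 4 1 ∷ nm 7 12 9 10 ∷ nm 10 4 5 6 ∷ nm 0 2 6 4 ∷ nm 6 9 3 9 ∷ nm 7 1 0 2 ∷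
      nm 3 7 10 2 ∷ nm 0 4 3 1 ∷ nm 3 5 2 8 ∷ nm 10 6 2 0 ∷ nm 0 1 12 9 ∷ nm 1 3 5 3 ∷
      nm 1 4 6 12 ∷ nm 10 6 0 4 ∷ nm 1 7 4 3 ∷ nm 7 0 0 2 ∷ nm 7 2 2 10 ∷ nm 10 7 0 4 ∷
      nm 11 3 8 7 ∷ nm 7 1 2 6 ∷ nm 0 2 6 0 ∷ nm 9 1 2 9 ∷ nm 12 12 0 12 ∷ nm 1 2 4 9 ∷
      nm 7 4 0 2 ∷ nm 7 6 2 0 ∷ nm 10 9 0 4 ∷ nm 11 7 2 12 ∷ nm 0 4 3 2 ∷ nm 8 12 12 10 ∷
      nm 11 1 0 6 ∷ nm 9 7 3 1 ∷ nm 1 4 4 4 ∷ nm 7 5 0 2 ∷ nm 3 5 10 4 ∷ nm 10 9 4 5 ∷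
      nm 1 1 8 9 ∷ nm 7 12 8 12 ∷ nm 7 0 3 2 ∷ nm 12 11 0 12 ∷ nm 3 0 3 9 ∷ nm 7 1 8 5 ∷
      nm 1 1 7 8 ∷ nm 5 4 0 8 ∷ nm 1 4 12 10 ∷ nm 0 1 12 1 ∷ nm 3 2 2 6 ∷ nm 9 3 2 8 ∷
      nm 0 4 3 8 ∷ nm 2 8 3 6 ∷ nm 9 8 0 3 ∷ nm 11 2 8 11 ∷ nm 3 3 10 6 ∷ nm 0 4 3 10 ∷
      nm 1 2 5 11 ∷ nm 10 10 2 6 ∷ nm 7 10 0 2 ∷ nm 2 6 2 0 ∷ nm 0 2 6 2 ∷ nm 10 0 2 4 ∷
      nm 9 2 0 3 ∷ nm 3 4 3 0 ∷ nm 0 2 6 11 ∷ nm 6 3 3 6 ∷ nm 9 9 0 3 ∷ nm 3 2 3 11 ∷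
      nm 7 10 8 6 ∷ nm 7 11 3 3 ∷ nm 12 2 0 12 ∷ nm 1 12 4 10 ∷ nm 0 1 12 8 ∷ nm 1 4 5 8 ∷
      nm 10 4 2 10 ∷ nm 7 11 0 2 ∷ nm 9 0 3 3 ∷ nm 11 1 2 5 ∷ nm 5 1 0 8 ∷ nm 9 6 3 5 ∷
      nm 11 4 2 2 ∷ [] )
  ∷ []

cycle : Fin 10 → Fin 91 → Fin 91
cycle j = lookup (lookup cycle-table j)

edge-witness : Fin 10 → Fin 91 → Mat
edge-witness j = fromN ∘ lookup (lookup edge-witness-table j)

sameCosetᵇ : Mat → Mat → Bool
sameCosetᵇ x y = isH₀ᴺ (toN (y *M invM x))

orbital-pairᵇ : Bool → Mat → Mat → Mat → Mat → Bool
orbital-pairᵇ true  s g u w = sameCosetᵇ (IM *M g) u ∧ sameCosetᵇ (s *M g) w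
orbital-pairᵇ false s g u w = sameCosetᵇ (s *M g) u ∧ sameCosetᵇ (IM *M g) w

orbital-pairᵇ-sound : ∀ b s g u w → orbital-pairᵇ b s g u w ≡ true →
  SameCoset H₀ (IM *M g) u × SameCoset H₀ (s *M g) w ⊎ SameCoset H₀ (s *M g) u × SameCoset H₀ (IM *M g) w
orbital-pairᵇ-sound true  s g u w p = let hu , hw = ∧-split {sameCosetᵇ (IM *M g) u} p in inj₁ (mkH₀ hu , mkH₀ hw)
orbital-pairᵇ-sound false s g u w p = let hu , hw = ∧-split {sameCosetᵇ (s *M g) u} p in inj₂ (mkH₀ hu , mkH₀ hw)

cycle-edgeᵇ : Fin 10 → Fin 91 → Bool
cycle-edgeᵇ j i = isSLᴺ (toN (edge-witness j i)) ∧
  orbital-pairᵇ (lookup (lookup edge-orientation j) i) (suborbit-rep-coset j) (edge-witness j i)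
                (coset (cycle j i)) (coset (cycle j (nextF i)))

module _ {O : Mat → Mat → Bool} (G : IsGenOrbitalGraph H₀ O) where

  cycle-hamiltonian : ∀ j → O IM (suborbit-rep-coset j) ≡ true → HasHamiltonCycle H₀ O
  cycle-hamiltonian j e = 88 , coset ∘ cycle j , SL-coset ∘ cycle j , distinct , covers , edges
    where
    distinct : ∀ i i' → SameCoset H₀ (coset (cycle j i)) (coset (cycle j i')) → i ≡ i'
    distinct i i' h = lookup-injective (uniqueᵇ-sound (lookup cycle-table j) (allᵇ-sound uniqueᵇ cycle-table refl j))
                        i i' (coset-distinct (cycle j i) (cycle j i') h)

    covers : ∀ x → SL x → ∃[ i ] SameCoset H₀ x (coset (cycle j i))
    covers x sx =
      let k , h = coset-cover x sx
          i , p = exhaustiveᵇ-sound (lookup cycle-table j) (allᵇ-sound exhaustiveᵇ cycle-table refl j) k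
      in i , subst (SameCoset H₀ x ∘ coset) (sym p) h

    edges : ∀ i → O (coset (cycle j i)) (coset (cycle j (nextF i))) ≡ true
    edges i =
      let sg , pair = ∧-split {isSLᴺ (toN (edge-witness j i))}
                        (allFinᵇ-sound 91 (cycle-edgeᵇ j) (allFinᵇ-sound 10 (λ j → allFinᵇ 91 (cycle-edgeᵇ j)) refl j) i)
      in O-orbital-edge G (SL-coset (lookup suborbit-rep j)) (isSLᴺ-sound (edge-witness j i) sg)
           (SL-coset (cycle j i)) (SL-coset (cycle j (nextF i))) e
           (orbital-pairᵇ-sound (lookup (lookup edge-orientation j) i) (suborbit-rep-coset j) (edge-witness j i)
              (coset (cycle j i)) (coset (cycle j (nextF i))) pair)

H₀-hamiltonian : ∀ O → IsGenOrbitalGraph H₀ O → HasHamiltonCycle H₀ O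
H₀-hamiltonian O G = let j , e = edge-to-suborbit-rep G in cycle-hamiltonian G j e

-- A₄ and its subgroups of PSL(2,13)

isA4ᵇ : Perm4 → Bool
isA4ᵇ σ = injectiveᵇ (lookup σ) ∧ (inversions σ % 2 ≡ᵇ 0)

isA4ᵇ-sound : ∀ σ → isA4ᵇ σ ≡ true → IsA4 σ
isA4ᵇ-sound σ p = let inj , even = ∧-split {injectiveᵇ (lookup σ)} p in
  injectiveᵇ-sound (lookup σ) inj , ≡ᵇ-sound _ 0 even

isA4ᵇ-complete : ∀ σ → IsA4 σ → isA4ᵇ σ ≡ true
isA4ᵇ-complete σ (inj , even) = ∧-intro (injectiveᵇ-complete (lookup σ) inj) (≡ᵇ-complete _ 0 even)

_≡ᵖ_ : Perm4 → Perm4 → Bool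
σ ≡ᵖ τ = allFinᵇ 4 λ i → lookup σ i ≡ᶠᵇ lookup τ i

≡ᵖ-sound : ∀ σ τ → σ ≡ᵖ τ ≡ true → σ ≡ τ
≡ᵖ-sound σ τ p = begin
  σ                ≡⟨ sym (tabulate∘lookup σ) ⟩
  tabulate (lookup σ) ≡⟨ tabulate-cong (λ i → ≡ᶠᵇ-sound (lookup σ i) (lookup τ i) (allFinᵇ-sound 4 (λ i → lookup σ i ≡ᶠᵇ lookup τ i) p i)) ⟩
  tabulate (lookup τ) ≡⟨ tabulate∘lookup τ ⟩
  τ                ∎
  where open ≡-Reasoning

∘P-closed-A4 : ∀ σ τ → IsA4 σ → IsA4 τ → IsA4 (σ ∘P τ)
∘P-closed-A4 σ τ aσ aτ = isA4ᵇ-sound (σ ∘P τ) $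
  implies-elim (allVecᵇ-sound 4 (closedᵇ σ) (implies-elim (allVecᵇ-sound 4 check refl σ) (isA4ᵇ-complete σ aσ)) τ)
    (isA4ᵇ-complete τ aτ)
  where
  closedᵇ : Perm4 → Perm4 → Bool
  closedᵇ σ τ = not (isA4ᵇ τ) ∨ isA4ᵇ (σ ∘P τ)
  check : Perm4 → Bool
  check σ = not (isA4ᵇ σ) ∨ allVecᵇ 4 (closedᵇ σ)

infixl 7 _·_
data Word : Set where
  α β : Word
  _·_ : Word → Word → Word

evalPerm : Word → Perm4
evalPerm α       = # 1 ∷ # 0 ∷ # 3 ∷ # 2 ∷ []
evalPerm β       = # 1 ∷ # 2 ∷ # 0 ∷ # 3 ∷ []
evalPerm (u · v) = evalPerm u ∘P evalPerm v

evalMat : Mat → Mat → Word → Mat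
evalMat x y α       = x
evalMat x y β       = y
evalMat x y (u · v) = evalMat x y u *M evalMat x y v

evalᴺ : NMat → NMat → Word → NMat
evalᴺ x y α       = x
evalᴺ x y β       = y
evalᴺ x y (u · v) = evalᴺ x y u *ᴺ evalᴺ x y v

evalPerm-A4 : ∀ w → IsA4 (evalPerm w)
evalPerm-A4 α       = isA4ᵇ-sound (evalPerm α) refl
evalPerm-A4 β       = isA4ᵇ-sound (evalPerm β) refl
evalPerm-A4 (u · v) = ∘P-closed-A4 (evalPerm u) (evalPerm v) (evalPerm-A4 u) (evalPerm-A4 v)

toN-evalMat : ∀ x y w → toN (evalMat x y w) ≡ evalᴺ (toN x) (toN y) w
toN-evalMat x y α       = refl
toN-evalMat x y β       = refl
toN-evalMat x y (u · v) =
  trans (toN-*M (evalMat x y u) (evalMat x y v)) (cong₂ _*ᴺ_ (toN-evalMat x y u) (toN-evalMat x y v))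

conj-evalMat : ∀ c x y w → SL c → conj c (evalMat x y w) ≡ evalMat (conj c x) (conj c y) w
conj-evalMat c x y α       sc = refl
conj-evalMat c x y β       sc = refl
conj-evalMat c x y (u · v) sc =
  trans (conj-*M c (evalMat x y u) (evalMat x y v) sc)
        (cong₂ _*M_ (conj-evalMat c x y u sc) (conj-evalMat c x y v sc))

A4-words : Vec Word 12
A4-words = α · α ∷ β · β · α ∷ α · β ∷ α ∷ β ∷ β · α · β ∷ β · β ∷ β · α ∷ β · β · α · β ∷ α · β · α
         ∷ α · β · β ∷ β · α · β · β ∷ []

A4-words-complete : ∀ σ → IsA4 σ → ∃[ k ] σ ≡ evalPerm (lookup A4-words k)
A4-words-complete σ aσ =
  let k , p = anyᵇ-sound (λ w → σ ≡ᵖ evalPerm w) A4-words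
                (implies-elim (allVecᵇ-sound 4 listedᵇ refl σ) (isA4ᵇ-complete σ aσ))
  in k , ≡ᵖ-sound σ _ p
  where
  listedᵇ : Perm4 → Bool
  listedᵇ σ = not (isA4ᵇ σ) ∨ anyᵇ (λ w → σ ≡ᵖ evalPerm w) A4-words

conjᴺ : NMat → NMat → NMat
conjᴺ c x = (c *ᴺ x) *ᴺ invᴺ c

toN-conj : ∀ c x → toN (conj c x) ≡ conjᴺ (toN c) (toN x)
toN-conj c x = trans (toN-*M (c *M x) (invM c)) (cong₂ _*ᴺ_ (toN-*M c x) (toN-invM c))

relatorᵇ : NMat → NMat → Word → Bool
relatorᵇ x y w = evalᴺ x y w ≈ᴺ toN IM

relatorᵇ-complete : ∀ x y w → evalMat x y w ≈P IM → relatorᵇ (toN x) (toN y) w ≡ true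
relatorᵇ-complete x y w r = subst (λ n → n ≈ᴺ toN IM ≡ true) (toN-evalMat x y w) (≈ᴺ-complete _ IM r)

nontrivialᵇ-complete : ∀ x → ¬ x ≈P IM → not (toN x ≈ᴺ toN IM) ≡ true
nontrivialᵇ-complete x x≉IM = not-intro (x≉IM ∘ ≈ᴺ-sound x IM)

candidates-cover : ∀ {n} (P : NMat → Bool) (good : NMat → NMat → Bool) (candidates : Vec NMat n) →
  (allMat λ x → not (P (toN x)) ∨ anyᵇ (good (toN x)) candidates) ≡ true →
  ∀ x → P (toN x) ≡ true → ∃[ k ] good (toN x) (lookup candidates k) ≡ true
candidates-cover P good candidates check x Px =
  anyᵇ-sound (good (toN x)) candidates
    (implies-elim {P (toN x)} (allMat-sound (λ x → not (P (toN x)) ∨ anyᵇ (good (toN x)) candidates) check x) Px)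

conjugatorᵇ : (NMat → Bool) → NMat → Bool
conjugatorᵇ p c = isReducedᴺ c ∧ (isSLᴺ c ∧ p c)

conjugatorᵇ-sound : ∀ p c → conjugatorᵇ p c ≡ true → SL (fromN c) × p (toN (fromN c)) ≡ true
conjugatorᵇ-sound p c q =
  let red , rest = ∧-split {isReducedᴺ c} q
      sl , pc = ∧-split {isSLᴺ c} rest
      toN-c = toN-fromN c red
  in isSLᴺ-sound (fromN c) (subst (λ n → isSLᴺ n ≡ true) (sym toN-c) sl) , subst (λ n → p n ≡ true) (sym toN-c) pc

-- A₀ = diag(5, 8): since 5 · 8 ≡ 1 and 5² ≡ -1 (mod 13), it is an involution of PSL(2,13).
A₀ : Mat
A₀ = fromN (nm 5 0 0 8)

involution-conjugators : Vec NMat 182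
involution-conjugators =
  nm 1 8 4 7 ∷ nm 1 3 2 7 ∷ nm 1 11 10 7 ∷ nm 1 6 1 7 ∷ nm 1 1 6 7 ∷ nm 1 9 5 7 ∷ nm 1 4 8 7 ∷
  nm 1 12 7 7 ∷ nm 1 7 12 7 ∷ nm 1 2 3 7 ∷ nm 1 10 11 7 ∷ nm 1 5 9 7 ∷ nm 1 11 8 11 ∷
  nm 1 9 4 11 ∷ nm 1 7 7 11 ∷ nm 1 5 2 11 ∷ nm 1 3 12 11 ∷ nm 1 1 10 11 ∷ nm 1 12 3 11 ∷
  nm 1 10 1 11 ∷ nm 1 8 11 11 ∷ nm 1 6 6 11 ∷ nm 1 4 9 11 ∷ nm 1 2 5 11 ∷ nm 1 2 7 2 ∷
  nm 1 4 10 2 ∷ nm 1 6 11 2 ∷ nm 1 8 5 2 ∷ nm 1 10 4 2 ∷ nm 1 12 12 2 ∷ nm 1 1 1 2 ∷ nm 1 3 9 2 ∷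
  nm 1 5 8 2 ∷ nm 1 7 2 2 ∷ nm 1 9 3 2 ∷ nm 1 11 6 2 ∷ nm 1 5 1 6 ∷ nm 1 10 7 6 ∷ nm 1 2 9 6 ∷
  nm 1 7 10 6 ∷ nm 1 12 8 6 ∷ nm 1 4 11 6 ∷ nm 1 9 2 6 ∷ nm 1 1 5 6 ∷ nm 1 6 3 6 ∷ nm 1 11 4 6 ∷
  nm 1 3 6 6 ∷ nm 1 8 12 6 ∷ nm 1 3 3 10 ∷ nm 1 6 8 10 ∷ nm 1 9 1 10 ∷ nm 1 12 4 10 ∷
  nm 1 2 11 10 ∷ nm 1 5 7 10 ∷ nm 1 8 6 10 ∷ nm 1 11 2 10 ∷ nm 1 1 9 10 ∷ nm 1 4 12 10 ∷
  nm 1 7 5 10 ∷ nm 1 10 10 10 ∷ nm 1 0 0 1 ∷ nm 1 0 9 1 ∷ nm 1 0 5 1 ∷ nm 1 0 1 1 ∷ nm 1 0 10 1 ∷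
  nm 1 0 6 1 ∷ nm 1 0 2 1 ∷ nm 1 0 11 1 ∷ nm 1 0 7 1 ∷ nm 1 0 3 1 ∷ nm 1 0 12 1 ∷ nm 1 0 8 1 ∷
  nm 1 0 4 1 ∷ nm 1 4 0 1 ∷ nm 1 8 0 1 ∷ nm 1 12 0 1 ∷ nm 1 3 0 1 ∷ nm 1 7 0 1 ∷ nm 1 11 0 1 ∷
  nm 1 2 0 1 ∷ nm 1 6 0 1 ∷ nm 1 10 0 1 ∷ nm 1 1 0 1 ∷ nm 1 5 0 1 ∷ nm 1 9 0 1 ∷ nm 1 6 5 5 ∷
  nm 1 12 9 5 ∷ nm 1 5 6 5 ∷ nm 1 11 11 5 ∷ nm 1 4 1 5 ∷ nm 1 10 3 5 ∷ nm 1 3 10 5 ∷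
  nm 1 9 12 5 ∷ nm 1 2 2 5 ∷ nm 1 8 7 5 ∷ nm 1 1 4 5 ∷ nm 1 7 8 5 ∷ nm 1 12 5 9 ∷ nm 1 11 9 9 ∷
  nm 1 10 6 9 ∷ nm 1 9 11 9 ∷ nm 1 8 1 9 ∷ nm 1 7 3 9 ∷ nm 1 6 10 9 ∷ nm 1 5 12 9 ∷ nm 1 4 2 9 ∷
  nm 1 3 7 9 ∷ nm 1 2 4 9 ∷ nm 1 1 8 9 ∷ nm 0 1 12 0 ∷ nm 1 10 9 0 ∷ nm 1 5 5 0 ∷ nm 1 12 1 0 ∷
  nm 1 9 10 0 ∷ nm 1 2 6 0 ∷ nm 1 6 2 0 ∷ nm 1 7 11 0 ∷ nm 1 11 7 0 ∷ nm 1 4 3 0 ∷ nm 1 1 12 0 ∷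
  nm 1 8 8 0 ∷ nm 1 3 4 0 ∷ nm 0 1 12 4 ∷ nm 0 1 12 8 ∷ nm 0 1 12 12 ∷ nm 0 1 12 3 ∷
  nm 0 1 12 7 ∷ nm 0 1 12 11 ∷ nm 0 1 12 2 ∷ nm 0 1 12 6 ∷ nm 0 1 12 10 ∷ nm 0 1 12 1 ∷
  nm 0 1 12 5 ∷ nm 0 1 12 9 ∷ nm 1 1 3 4 ∷ nm 1 2 8 4 ∷ nm 1 3 1 4 ∷ nm 1 4 4 4 ∷ nm 1 5 11 4 ∷
  nm 1 6 7 4 ∷ nm 1 7 6 4 ∷ nm 1 8 2 4 ∷ nm 1 9 9 4 ∷ nm 1 10 12 4 ∷ nm 1 11 5 4 ∷ nm 1 12 10 4 ∷
  nm 1 7 1 8 ∷ nm 1 1 7 8 ∷ nm 1 8 9 8 ∷ nm 1 2 10 8 ∷ nm 1 9 8 8 ∷ nm 1 3 11 8 ∷ nm 1 10 2 8 ∷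
  nm 1 4 5 8 ∷ nm 1 11 3 8 ∷ nm 1 5 4 8 ∷ nm 1 12 6 8 ∷ nm 1 6 12 8 ∷ nm 1 9 7 12 ∷
  nm 1 5 10 12 ∷ nm 1 1 11 12 ∷ nm 1 10 5 12 ∷ nm 1 6 4 12 ∷ nm 1 2 12 12 ∷ nm 1 11 1 12 ∷
  nm 1 7 9 12 ∷ nm 1 3 8 12 ∷ nm 1 12 2 12 ∷ nm 1 8 3 12 ∷ nm 1 4 6 12 ∷ nm 1 10 8 3 ∷
  nm 1 7 4 3 ∷ nm 1 4 7 3 ∷ nm 1 1 2 3 ∷ nm 1 11 12 3 ∷ nm 1 8 10 3 ∷ nm 1 5 3 3 ∷ nm 1 2 1 3 ∷
  nm 1 12 11 3 ∷ nm 1 9 6 3 ∷ nm 1 6 9 3 ∷ nm 1 3 5 3 ∷ []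

involutionᵇ : NMat → Bool
involutionᵇ n = isSLᴺ n ∧ (relatorᵇ n n (α · α) ∧ not (n ≈ᴺ toN IM))

conjugates-to-A₀ᵇ : NMat → NMat → Bool
conjugates-to-A₀ᵇ n = conjugatorᵇ λ c → conjᴺ c n ≡ᴺ toN A₀

involutions-conjugate-check :
  (allMat λ x → not (involutionᵇ (toN x)) ∨ anyᵇ (conjugates-to-A₀ᵇ (toN x)) involution-conjugators) ≡ true
involutions-conjugate-check = refl

involution-conjugate : ∀ x → SL x → (x *M x) ≈P IM → ¬ x ≈P IM → ∃[ c ] SL c × conj c x ≡ A₀
involution-conjugate x sx x²≈IM x≉IM =
  let k , p = candidates-cover involutionᵇ conjugates-to-A₀ᵇ involution-conjugators
                involutions-conjugate-check x involution
      c = fromN (lookup involution-conjugators k)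
      sc , conj≡A₀ = conjugatorᵇ-sound (λ c → conjᴺ c (toN x) ≡ᴺ toN A₀) (lookup involution-conjugators k) p
  in c , sc , toN-injective (trans (toN-conj c x) (≡ᴺ-sound _ _ conj≡A₀))
  where
  involution : involutionᵇ (toN x) ≡ true
  involution = ∧-intro {isSLᴺ (toN x)} (isSLᴺ-complete x sx)
    (∧-intro {relatorᵇ (toN x) (toN x) (α · α)} (relatorᵇ-complete x x (α · α) x²≈IM) (nontrivialᵇ-complete x x≉IM))

Generates-H₀ : Mat → Mat → Set
Generates-H₀ x y = (∀ k → H₀ (evalMat x y (lookup A4-words k))) ×
                   (∀ i → ∃[ k ] H₀-element i ≈P evalMat x y (lookup A4-words k))

generates-H₀ᵇ : NMat → NMat → Bool
generates-H₀ᵇ x y = allᵇ (λ w → isH₀ᴺ (evalᴺ x y w)) A4-words ∧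
                    allᵇ (λ h → anyᵇ (λ w → h ≈ᴺ evalᴺ x y w) A4-words) H₀-table

generates-H₀ᵇ-sound : ∀ x y {m n} → toN x ≡ m → toN y ≡ n → generates-H₀ᵇ m n ≡ true → Generates-H₀ x y
generates-H₀ᵇ-sound x y refl refl p =
  let members , exhausts = ∧-split {allᵇ (λ w → isH₀ᴺ (evalᴺ (toN x) (toN y) w)) A4-words} p
  in (λ k → H₀-intro (toN-evalMat x y (lookup A4-words k))
              (allᵇ-sound (λ w → isH₀ᴺ (evalᴺ (toN x) (toN y) w)) A4-words members k)) ,
     (λ i → let k , q = anyᵇ-sound (λ w → lookup H₀-table i ≈ᴺ evalᴺ (toN x) (toN y) w) A4-words
                          (allᵇ-sound (λ h → anyᵇ (λ w → h ≈ᴺ evalᴺ (toN x) (toN y) w) A4-words) H₀-table exhausts i)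
            in k , ≈ᴺ-sound (H₀-element i) (evalMat x y (lookup A4-words k))
                     (subst₂ (λ m n → m ≈ᴺ n ≡ true) (sym (toN-H₀-element i)) (sym (toN-evalMat x y (lookup A4-words k))) q))

A4-conjugators : Vec NMat 3
A4-conjugators =
  nm 0 1 12 0 ∷ nm 0 2 6 0 ∷ nm 0 4 3 0 ∷ []

A4-relatorsᵇ : NMat → Bool
A4-relatorsᵇ n = isSLᴺ n ∧ (relatorᵇ (toN A₀) n (β · β · β) ∧
                 (relatorᵇ (toN A₀) n (α · β · (α · β) · (α · β)) ∧ not (n ≈ᴺ toN IM)))

generates-conjugate-H₀ᵇ : NMat → NMat → Bool
generates-conjugate-H₀ᵇ n = conjugatorᵇ λ c → generates-H₀ᵇ (conjᴺ c (toN A₀)) (conjᴺ c n)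

A4-pairs-conjugate-check :
  (allMat λ x → not (A4-relatorsᵇ (toN x)) ∨ anyᵇ (generates-conjugate-H₀ᵇ (toN x)) A4-conjugators) ≡ true
A4-pairs-conjugate-check = refl

A4-relatorsᵇ-complete : ∀ y → SL y → evalMat A₀ y (β · β · β) ≈P IM →
                        evalMat A₀ y (α · β · (α · β) · (α · β)) ≈P IM → ¬ y ≈P IM → A4-relatorsᵇ (toN y) ≡ true
A4-relatorsᵇ-complete y sy r₁ r₂ y≉IM =
  ∧-intro {isSLᴺ (toN y)} (isSLᴺ-complete y sy)
    (∧-intro {relatorᵇ (toN A₀) (toN y) (β · β · β)} (relatorᵇ-complete A₀ y (β · β · β) r₁)
      (∧-intro {relatorᵇ (toN A₀) (toN y) (α · β · (α · β) · (α · β))}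
        (relatorᵇ-complete A₀ y (α · β · (α · β) · (α · β)) r₂) (nontrivialᵇ-complete y y≉IM)))

generates-conjugate-H₀ᵇ-sound : ∀ y c → generates-conjugate-H₀ᵇ (toN y) c ≡ true →
  SL (fromN c) × Generates-H₀ (conj (fromN c) A₀) (conj (fromN c) y)
generates-conjugate-H₀ᵇ-sound y c p =
  let sc , gen = conjugatorᵇ-sound (λ c → generates-H₀ᵇ (conjᴺ c (toN A₀)) (conjᴺ c (toN y))) c p
  in sc , generates-H₀ᵇ-sound (conj (fromN c) A₀) (conj (fromN c) y) (toN-conj (fromN c) A₀) (toN-conj (fromN c) y) gen

A4-pair-conjugate : ∀ y → SL y → evalMat A₀ y (β · β · β) ≈P IM →
                    evalMat A₀ y (α · β · (α · β) · (α · β)) ≈P IM → ¬ y ≈P IM →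
                    ∃[ c ] SL c × Generates-H₀ (conj c A₀) (conj c y)
A4-pair-conjugate y sy r₁ r₂ y≉IM =
  let k , p = candidates-cover A4-relatorsᵇ generates-conjugate-H₀ᵇ A4-conjugators A4-pairs-conjugate-check y
                (A4-relatorsᵇ-complete y sy r₁ r₂ y≉IM)
  in fromN (lookup A4-conjugators k) , generates-conjugate-H₀ᵇ-sound y (lookup A4-conjugators k) p

module A4-subgroup {H : Mat → Set} (isSubgroup : IsPSLSubgroup H) (iso : IsoToA4 H) where
  open IsPSLSubgroup isSubgroup
  open IsoToA4 iso
  open ≈P-Reasoning

  A B : Mat
  A = φ (evalPerm α)
  B = φ (evalPerm β)

  word : Word → Mat
  word = evalMat A B

  φ-evalPerm : ∀ w → φ (evalPerm w) ≈P word w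
  φ-evalPerm α       = ≈P-refl
  φ-evalPerm β       = ≈P-refl
  φ-evalPerm (u · v) = ≈P-trans (hom (evalPerm u) (evalPerm v) (evalPerm-A4 u) (evalPerm-A4 v))
                                (≈P-*M (φ-evalPerm u) (φ-evalPerm v))

  word-∈ : ∀ w → H (word w)
  word-∈ α       = into (evalPerm α) (evalPerm-A4 α)
  word-∈ β       = into (evalPerm β) (evalPerm-A4 β)
  word-∈ (u · v) = mulClosed (word u) (word v) (word-∈ u) (word-∈ v)

  id₄ : Perm4
  id₄ = evalPerm (α · α)

  φ-id₄ : φ id₄ ≈P IM
  φ-id₄ = idempotent⇒≈P-IM (φ id₄) (⊆SL (φ id₄) (into id₄ id₄-A4)) (hom id₄ id₄ id₄-A4 id₄-A4)
    where
    id₄-A4 : IsA4 id₄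
    id₄-A4 = evalPerm-A4 (α · α)

  relator : ∀ w → evalPerm w ≡ id₄ → word w ≈P IM
  relator w w≡id = begin
    word w          ≈⟨ ≈P-sym (φ-evalPerm w) ⟩
    φ (evalPerm w)  ≡⟨ cong φ w≡id ⟩
    φ id₄           ≈⟨ φ-id₄ ⟩
    IM              ∎

  nontrivial : ∀ w → evalPerm w ≢ id₄ → ¬ word w ≈P IM
  nontrivial w w≢id w≈IM = w≢id (inj (evalPerm w) id₄ (evalPerm-A4 w) (evalPerm-A4 (α · α))
    (≈P-trans (φ-evalPerm w) (≈P-trans w≈IM (≈P-sym φ-id₄))))

  conj-relator : ∀ c w → SL c → word w ≈P IM → evalMat (conj c A) (conj c B) w ≈P IM
  conj-relator c w sc w≈IM = begin
    evalMat (conj c A) (conj c B) w ≡⟨ sym (conj-evalMat c A B w sc) ⟩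
    conj c (word w)                 ≈⟨ conj-≈P c w≈IM ⟩
    conj c IM                       ≡⟨ conj-IM c sc ⟩
    IM                              ∎

  A-conjugate : ∃[ c ] SL c × conj c A ≡ A₀
  A-conjugate = involution-conjugate A (⊆SL A (word-∈ α)) (relator (α · α) refl) (nontrivial α λ ())

  module _ (c₁ : Mat) (sc₁ : SL c₁) (c₁A≡A₀ : conj c₁ A ≡ A₀) where
    B' : Mat
    B' = conj c₁ B

    B'-relator : ∀ w → evalPerm w ≡ id₄ → evalMat A₀ B' w ≈P IM
    B'-relator w w≡id = subst (λ a → evalMat a B' w ≈P IM) c₁A≡A₀ (conj-relator c₁ w sc₁ (relator w w≡id))

    B'-nontrivial : ¬ B' ≈P IM
    B'-nontrivial B'≈IM =
      nontrivial β (λ ()) (conj-≈P-cancel c₁ sc₁ (≈P-trans B'≈IM (≈P-sym (≡⇒≈P (conj-IM c₁ sc₁)))))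

    B'-conjugate : ∃[ c ] SL c × Generates-H₀ (conj c A₀) (conj c B')
    B'-conjugate = A4-pair-conjugate B' (SL-conj c₁ B sc₁ (⊆SL B (word-∈ β)))
      (B'-relator (β · β · β) refl) (B'-relator (α · β · (α · β) · (α · β)) refl) B'-nontrivial

    compose-conjugators : ∀ c₂ → Generates-H₀ (conj c₂ A₀) (conj c₂ B') →
                          Generates-H₀ (conj (c₂ *M c₁) A) (conj (c₂ *M c₁) B)
    compose-conjugators c₂ = subst₂ Generates-H₀
      (sym (trans (conj-*M-conj c₂ c₁ A) (cong (conj c₂) c₁A≡A₀))) (sym (conj-*M-conj c₂ c₁ B))

  conjugate-generating-H₀ : ∃[ C ] SL C × Generates-H₀ (conj C A) (conj C B)
  conjugate-generating-H₀ =
    let c₁ , sc₁ , c₁A≡A₀ = A-conjugate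
        c₂ , sc₂ , generates = B'-conjugate c₁ sc₁ c₁A≡A₀
    in c₂ *M c₁ , SL-*M c₂ c₁ sc₂ sc₁ , compose-conjugators c₁ sc₁ c₁A≡A₀ c₂ generates

  generators-conjugate⇒conjugate : ∀ C → SL C → Generates-H₀ (conj C A) (conj C B) →
                                   ∀ m → H m ⇔ H₀ (conj C m)
  generators-conjugate⇒conjugate C sC (members , exhausts) m = mk⇔ into-H₀ from-H₀
    where
    conj-word : ∀ w → conj C (word w) ≡ evalMat (conj C A) (conj C B) w
    conj-word w = conj-evalMat C A B w sC

    into-H₀ : H m → H₀ (conj C m)
    into-H₀ m∈H =
      let σ , σ-A4 , φσ≈m = onto m m∈H
          k , σ≡ = A4-words-complete σ σ-A4
          w = lookup A4-words k
      in H₀-resp (evalMat (conj C A) (conj C B) w) (conj C m) (begin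
           evalMat (conj C A) (conj C B) w ≡⟨ sym (conj-word w) ⟩
           conj C (word w)                 ≈⟨ conj-≈P C (≈P-sym (φ-evalPerm w)) ⟩
           conj C (φ (evalPerm w))         ≡⟨ cong (conj C ∘ φ) (sym σ≡) ⟩
           conj C (φ σ)                    ≈⟨ conj-≈P C φσ≈m ⟩
           conj C m                        ∎) (members k)

    from-H₀ : H₀ (conj C m) → H m
    from-H₀ Cm∈H₀ =
      let i , Cm≈h = H₀-elements (conj C m) Cm∈H₀
          k , h≈w = exhausts i
          w = lookup A4-words k
      in resp (word w) m (conj-≈P-cancel C sC (begin
           conj C (word w)                 ≡⟨ conj-word w ⟩
           evalMat (conj C A) (conj C B) w ≈⟨ ≈P-sym h≈w ⟩
           H₀-element i                    ≈⟨ ≈P-sym Cm≈h ⟩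
           conj C m                        ∎)) (word-∈ w)

  conjugate-to-H₀ : ∃[ C ] SL C × (∀ m → H m ⇔ H₀ (conj C m))
  conjugate-to-H₀ =
    let C , sC , generates = conjugate-generating-H₀
    in C , sC , generators-conjugate⇒conjugate C sC generates

conjugate-to-H₀⇒hamiltonian : ∀ {H} C → SL C → (∀ m → H m ⇔ H₀ (conj C m)) →
                              ∀ O → IsGenOrbitalGraph H O → HasHamiltonCycle H O
conjugate-to-H₀⇒hamiltonian C sC H⇔H₀ O G =
  pullback-hamiltonCycle {O} (H₀-hamiltonian (pullback O) (pullback-isGenOrbitalGraph {O} G))
  where open ConjugateCosets {H' = H₀} C sC H⇔H₀

proposition5p3 : (H : Mat → Set) → IsPSLSubgroup H → IsoToA4 H →
    (O : Mat → Mat → Bool) → IsGenOrbitalGraph H O → HasHamiltonCycle H O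
proposition5p3 H isSubgroup iso =
  let C , sC , H⇔H₀ = A4-subgroup.conjugate-to-H₀ isSubgroup iso
  in conjugate-to-H₀⇒hamiltonian C sC H⇔H₀
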